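{- Let $G=(V,E)$ be a finite simple undirected graph and let $a\in V$ be a node with $\deg(a)=2$, say $\Gamma(a)=\{u,v\}$, such that $\{u,v\}\notin E$ and $\{a\}$ is not a separation clique of $G$. Then for any minimum fill-in ordering $\tau$ of the elimination graph $G_a$, the ordering of $G$ that eliminates $a$ first and then the remaining nodes in the order $\tau$ is a minimum fill-in ordering of $G$.
   Context: A set $S\subseteq V$ is a separation clique of $G$ if $S$ is a clique and $V\setminus S$ can be partitioned into two nonempty sets $V_1,V_2$ with no edge between $V_1$ and $V_2$. The deficiency of $x$ in $G$ is $D_G(x)=\{\{c,d\}: c,d\in\Gamma_G(x),\ c\neq d,\ \{c,d\}\notin E\}$. Eliminating $x$ gives $G_x=(V\setminus\{x\},\,E(V\setminus\{x\})\cup D_G(x))$, where $E(U)$ denotes the edges with both endpoints in $U$. A node ordering of $G$ with $n=|V|$ is a bijection $\sigma:\{1,\dots,n\}\to V$; it defines $G^{(0)}=G$, $G^{(i)}=(G^{(i-1)})_{\sigma(i)}$, and has fill-in $\phi(G,\sigma)=\sum_{i=1}^n|D_{G^{(i-1)}}(\sigma(i))|$. $\Phi(G)=\min_\sigma\phi(G,\sigma)$, and $\sigma$ is a minimum fill-in ordering if $\phi(G,\sigma)=\Phi(G)$. -}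

module Defs where

open import Data.Nat using (ℕ; _≤_)
open import Data.Bool using (Bool; true; false; _∧_; _∨_; not; if_then_else_)
open import Data.Fin using (Fin; _<?_)
open import Data.Fin.Properties using () renaming (_≟_ to _≟ᶠ_)
open import Data.List using (List; []; _∷_; map; allFin)
open import Data.Nat.ListAction using (sum)
open import Data.List.Relation.Unary.Unique.Propositional using (Unique)
open import Data.List.Membership.Propositional using (_∈_)
open import Data.Product using (_×_; Σ; ∃; ∃-syntax)
open import Relation.Binary.PropositionalEquality using (_≡_; _≢_)
open import Relation.Nullary.Decidable using (⌊_⌋)
open import Function.Bundles using (_⇔_)

-- A (raw) graph whose node set V is a subset of the universe Fin N,
-- with edges given by a Boolean adjacency relation.
record Graph (N : ℕ) : Set where
  constructor mkGraph
  field
    V   : Fin N → Bool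
    adj : Fin N → Fin N → Bool
open Graph public

record IsSimpleGraph {N : ℕ} (G : Graph N) : Set where
  field
    sym     : ∀ x y → adj G x y ≡ adj G y x
    irrefl  : ∀ x → adj G x x ≡ false
    inV     : ∀ x y → adj G x y ≡ true → V G x ≡ true

_==_ : ∀ {N} → Fin N → Fin N → Bool
x == y = ⌊ x ≟ᶠ y ⌋

nbr : ∀ {N} → Graph N → Fin N → Fin N → Bool
nbr G x y = V G y ∧ adj G x y ∧ not (x == y)

count : ∀ {N} → (Fin N → Bool) → ℕ
count {N} p = sum (map (λ i → if p i then 1 else 0) (allFin N))

-- |D_G(x)|: unordered pairs {c,d} (counted once, via c < d) of distinct
-- neighbours of x that are not adjacent.
deficiency : ∀ {N} → Graph N → Fin N → ℕ
deficiency {N} G x =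
  sum (map (λ c → count (λ d → ⌊ c <? d ⌋ ∧ nbr G x c ∧ nbr G x d ∧ not (adj G c d)))
           (allFin N))

elim : ∀ {N} → Graph N → Fin N → Graph N
elim G x = mkGraph V' adj'
  where
  V' : _ → Bool
  V' y = V G y ∧ not (y == x)
  adj' : _ → _ → Bool
  adj' c d = (adj G c d ∧ V' c ∧ V' d)
             ∨ (nbr G x c ∧ nbr G x d ∧ not (c == d))

IsOrdering : ∀ {N} → Graph N → List (Fin N) → Set
IsOrdering G σ = Unique σ × (∀ y → (y ∈ σ) ⇔ (V G y ≡ true))

fillIn : ∀ {N} → Graph N → List (Fin N) → ℕ
fillIn G []      = 0
fillIn G (x ∷ σ) = deficiency G x Data.Nat.+ fillIn (elim G x) σ

IsMinFillOrdering : ∀ {N} → Graph N → List (Fin N) → Set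
IsMinFillOrdering G σ = IsOrdering G σ × (∀ σ' → IsOrdering G σ' → fillIn G σ ≤ fillIn G σ')

IsSeparationClique : ∀ {N} → Graph N → (Fin N → Bool) → Set
IsSeparationClique {N} G S =
  (∀ x → S x ≡ true → V G x ≡ true)
  × (∀ x y → S x ≡ true → S y ≡ true → x ≢ y → adj G x y ≡ true)
  × Σ (Fin N → Bool) λ V₁ → (
      (∀ x → V₁ x ≡ true → (V G x ∧ not (S x)) ≡ true)
    × (∃ λ (x : Fin N) → V₁ x ≡ true)
    × (∃ λ (x : Fin N) → (V G x ∧ not (S x) ∧ not (V₁ x)) ≡ true)
    × (∀ x y → V₁ x ≡ true → (V G y ∧ not (S y) ∧ not (V₁ y)) ≡ true
             → adj G x y ≡ false))

singleton : ∀ {N} → Fin N → Fin N → Bool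
singleton a x = x == a

module Submission where

-- Since D_G(a) = {uv}, φ(G, aτ) = 1 + φ(G_a, τ), so it suffices to turn every ordering σ of G
-- into an ordering ρ of G_a with φ(G_a, ρ) + 1 ≤ φ(G, σ).
-- This goes by induction on σ, according to its first vertex x:
--   x = a: take ρ = the rest of σ;
--   x = u (or v): renaming a ↔ u embeds G_a into G_u; as edges plus fill-in can only grow in a
--     supergraph, counting edges gives the bound, using deg u ≥ 2 because {a} does not separate G;
--   x adjacent to u and v: uv is a fill edge of x in G but already an edge of G_a, and a is
--     simplicial in G_x, so dropping a from the rest of σ costs nothing;
--   otherwise eliminating x and a commute, the hypotheses on a survive in G_x, and we recurse.

open import Defs
open import Data.Nat using (ℕ; zero; suc; _+_; _*_; _≤_; _≡ᵇ_; z≤n; s≤s)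
open import Data.Nat.Properties using (+-comm; +-assoc; +-identityʳ; ≤-refl; ≤-trans; ≤-reflexive; ≤-antisym; +-mono-≤; +-monoˡ-≤; +-monoʳ-≤; *-monoʳ-≤; *-distribˡ-+; *-cancelˡ-≤; +-cancelˡ-≤; m≤m+n; m≤n+m; ≡ᵇ⇒≡; +-0-commutativeMonoid; +-commutativeSemigroup)
open import Data.Nat.ListAction using (sum)
open import Data.Nat.Solver using (module +-*-Solver)
open import Algebra.Properties.CommutativeMonoid.Sum +-0-commutativeMonoid using (sum-syntax; sum-cong-≗; sum-replicate-zero; ∑-distrib-+; ∑-comm; ∑-permute)
open import Algebra.Properties.CommutativeSemigroup +-commutativeSemigroup using (xy∙z≈xz∙y)
open import Data.Bool using (Bool; true; false; _∧_; _∨_; not; if_then_else_; T)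
open import Data.Bool.Properties using (¬-not; ∧-identityʳ; ∧-zeroʳ; ∧-assoc; ∨-zeroʳ) renaming (_≟_ to _≟ᵇ_)
open import Data.Fin using (Fin; _<?_) renaming (zero to fzero; suc to fsuc)
open import Data.Fin.Properties using (_≟_; suc-injective; <-asym; <-cmp; <-irrefl; any?)
open import Data.Fin.Permutation using (Permutation; permutation)
open import Data.List using (List; []; _∷_; map; allFin; tabulate; filter)
open import Data.List.Membership.Propositional using (_∈_)
open import Data.List.Membership.Propositional.Properties using (∈-map⁺; ∈-map⁻; ∈-filter⁻; ∈-filter⁺)
open import Data.List.Relation.Unary.All as All using (All)
open import Data.List.Relation.Unary.AllPairs using (_∷_)
open import Data.List.Relation.Unary.Any using (here; there)
open import Data.List.Relation.Unary.Unique.Propositional.Properties using (map⁺; filter⁺)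
open import Data.Empty using (⊥-elim)
open import Data.Product using (_×_; _,_; Σ; ∃; proj₁; proj₂)
open import Data.Sum using (_⊎_; inj₁; inj₂; [_,_]′)
open import Data.Unit using (tt)
open import Function using (_∘_; _∘′_; id)
open import Function.Bundles using (mk⇔; Equivalence)
open import Relation.Binary.Definitions using (tri<; tri≈; tri>)
open import Relation.Binary.PropositionalEquality
open import Relation.Nullary using (¬_; yes; no; ¬?; contradiction)
open import Relation.Nullary.Decidable using (⌊_⌋)

∧-elimˡ : ∀ a {b} → (a ∧ b) ≡ true → a ≡ true
∧-elimˡ true _ = refl

∧-elimʳ : ∀ a {b} → (a ∧ b) ≡ true → b ≡ true
∧-elimʳ true h = h

∧-intro : ∀ {a b} → a ≡ true → b ≡ true → (a ∧ b) ≡ true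
∧-intro refl refl = refl

∨-elim : ∀ a {b} → (a ∨ b) ≡ true → a ≡ true ⊎ b ≡ true
∨-elim true  _ = inj₁ refl
∨-elim false h = inj₂ h

∨-false : ∀ a {b} → (a ∨ b) ≡ false → a ≡ false × b ≡ false
∨-false false h = refl , h

≡ᵇ-true⇒≡ : ∀ {m n} → (m ≡ᵇ n) ≡ true → m ≡ n
≡ᵇ-true⇒≡ {m} {n} h = ≡ᵇ⇒≡ m n (subst T (sym h) tt)

true≢false : true ≢ false
true≢false ()

not-elim : ∀ {b} → not b ≡ true → b ≡ false
not-elim {false} _ = refl

-- `all-true-sound n _ refl` proves the n-variable formula stated in its type by its truth table;
-- the formula itself is recovered from that type by pattern unification.
BoolFn : ℕ → Set
BoolFn zero    = Bool
BoolFn (suc n) = Bool → BoolFn n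

all-true : ∀ n → BoolFn n → Bool
all-true zero    b = b
all-true (suc n) f = all-true n (f true) ∧ all-true n (f false)

Valid : ∀ n → BoolFn n → Set
Valid zero    b = b ≡ true
Valid (suc n) f = ∀ b → Valid n (f b)

all-true-sound : ∀ n f → all-true n f ≡ true → Valid n f
all-true-sound zero    f h       = h
all-true-sound (suc n) f h true  = all-true-sound n (f true) (∧-elimˡ _ h)
all-true-sound (suc n) f h false = all-true-sound n (f false) (∧-elimʳ _ h)

infixr 4.3 _⇒ᵇ_
_⇒ᵇ_ : Bool → Bool → Bool
a ⇒ᵇ b = not a ∨ b

infix 4.6 _⇔ᵇ_
_⇔ᵇ_ : Bool → Bool → Bool
a ⇔ᵇ b = if a then b else not b

infixl 0 _∵_
_∵_ : ∀ {a b} → (a ⇒ᵇ b) ≡ true → a ≡ true → b ≡ true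
h ∵ refl = h

⇒ᵇ-intro : ∀ a {b} → (a ≡ true → b ≡ true) → (a ⇒ᵇ b) ≡ true
⇒ᵇ-intro true  f = f refl
⇒ᵇ-intro false _ = refl

⇔ᵇ-elim : ∀ {a b} → (a ⇔ᵇ b) ≡ true → a ≡ b
⇔ᵇ-elim {true}  {true}  _ = refl
⇔ᵇ-elim {false} {false} _ = refl

⇔ᵇ-intro : ∀ {a b} → a ≡ b → (a ⇔ᵇ b) ≡ true
⇔ᵇ-intro {true}  refl = refl
⇔ᵇ-intro {false} refl = refl

𝟙 : Bool → ℕ
𝟙 b = if b then 1 else 0

𝟙-mono : ∀ {a b} → (a ≡ true → b ≡ true) → 𝟙 a ≤ 𝟙 b
𝟙-mono {false} _ = z≤n
𝟙-mono {true}  h rewrite h refl = ≤-refl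

module _ {n : ℕ} where

  ==⇒≡ : {x y : Fin n} → (x == y) ≡ true → x ≡ y
  ==⇒≡ {x} {y} h with x ≟ y
  ... | yes x≡y = x≡y

  ==-refl : (x : Fin n) → (x == x) ≡ true
  ==-refl x with x ≟ x
  ... | yes _  = refl
  ... | no x≢x = ⊥-elim (x≢x refl)

  ≢⇒==false : {x y : Fin n} → x ≢ y → (x == y) ≡ false
  ≢⇒==false {x} {y} x≢y with x ≟ y
  ... | yes x≡y = ⊥-elim (x≢y x≡y)
  ... | no _    = refl

  ==false⇒≢ : {x y : Fin n} → (x == y) ≡ false → x ≢ y
  ==false⇒≢ {x} h refl with () ← trans (sym h) (==-refl x)

  ==-sym : (x y : Fin n) → (x == y) ≡ (y == x)
  ==-sym x y with x ≟ y | y ≟ x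
  ... | yes _   | yes _   = refl
  ... | no _    | no _    = refl
  ... | yes x≡y | no y≢x  = ⊥-elim (y≢x (sym x≡y))
  ... | no x≢y  | yes y≡x = ⊥-elim (x≢y (sym y≡x))

sum-map-tabulate : ∀ {A : Set} n (f : A → ℕ) (g : Fin n → A) →
                   sum (map f (tabulate g)) ≡ ∑[ i < n ] f (g i)
sum-map-tabulate zero    f g = refl
sum-map-tabulate (suc n) f g = cong (f (g fzero) +_) (sum-map-tabulate n f (g ∘ fsuc))

sum-map-allFin : ∀ n (f : Fin n → ℕ) → sum (map f (allFin n)) ≡ ∑[ i < n ] f i
sum-map-allFin n f = sum-map-tabulate n f id

∑-mono-≤ : ∀ {n} {f g : Fin n → ℕ} → (∀ i → f i ≤ g i) → ∑[ i < n ] f i ≤ ∑[ i < n ] g i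
∑-mono-≤ {zero}  f≤g = z≤n
∑-mono-≤ {suc n} f≤g = +-mono-≤ (f≤g fzero) (∑-mono-≤ (f≤g ∘ fsuc))

∑-≥ : ∀ {n} (f : Fin n → ℕ) k → f k ≤ ∑[ i < n ] f i
∑-≥ f fzero    = m≤m+n _ _
∑-≥ f (fsuc k) = ≤-trans (∑-≥ (f ∘ fsuc) k) (m≤n+m _ _)

∑-≥-pair : ∀ {n} (f : Fin n → ℕ) {p q} → p ≢ q → f p + f q ≤ ∑[ i < n ] f i
∑-≥-pair f {fzero}  {fzero}  p≢q = ⊥-elim (p≢q refl)
∑-≥-pair f {fzero}  {fsuc q} _   = +-monoʳ-≤ (f fzero) (∑-≥ (f ∘ fsuc) q)
∑-≥-pair f {fsuc p} {fzero}  _   = ≤-trans (≤-reflexive (+-comm (f (fsuc p)) _)) (+-monoʳ-≤ (f fzero) (∑-≥ (f ∘ fsuc) p))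
∑-≥-pair f {fsuc p} {fsuc q} p≢q = ≤-trans (∑-≥-pair (f ∘ fsuc) (p≢q ∘ cong fsuc)) (m≤n+m _ _)

∑-only : ∀ {n} (f : Fin n → ℕ) k → (∀ i → i ≢ k → f i ≡ 0) → ∑[ i < n ] f i ≡ f k
∑-only {suc n} f fzero    f≡0 = begin
  f fzero + ∑[ i < n ] f (fsuc i) ≡⟨ cong (f fzero +_) (trans (sum-cong-≗ (λ i → f≡0 (fsuc i) λ ())) (sum-replicate-zero n)) ⟩
  f fzero + 0                     ≡⟨ +-comm (f fzero) 0 ⟩
  f fzero                         ∎
  where open ≡-Reasoning
∑-only {suc n} f (fsuc k) f≡0 =
  cong₂ _+_ (f≡0 fzero λ ()) (∑-only (f ∘ fsuc) k (λ i i≢k → f≡0 (fsuc i) (i≢k ∘ suc-injective)))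

∑-𝟙-== : ∀ {n} (q : Fin n) → ∑[ d < n ] 𝟙 (d == q) ≡ 1
∑-𝟙-== q = trans (∑-only _ q (λ i i≢q → cong 𝟙 (≢⇒==false i≢q))) (cong 𝟙 (==-refl q))

∑² : ∀ {n} → (Fin n → Fin n → ℕ) → ℕ
∑² {n} r = ∑[ c < n ] ∑[ d < n ] r c d

module _ {n : ℕ} where

  ∑²-cong : {r s : Fin n → Fin n → ℕ} → (∀ c d → r c d ≡ s c d) → ∑² r ≡ ∑² s
  ∑²-cong r≡s = sum-cong-≗ (λ c → sum-cong-≗ (r≡s c))

  ∑²-mono-≤ : {r s : Fin n → Fin n → ℕ} → (∀ c d → r c d ≤ s c d) → ∑² r ≤ ∑² s
  ∑²-mono-≤ r≤s = ∑-mono-≤ (λ c → ∑-mono-≤ (r≤s c))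

  ∑²-distrib-+ : (r s : Fin n → Fin n → ℕ) → ∑² (λ c d → r c d + s c d) ≡ ∑² r + ∑² s
  ∑²-distrib-+ r s = trans (sum-cong-≗ (λ c → ∑-distrib-+ (r c) (s c))) (∑-distrib-+ {n} (λ c → ∑[ d < n ] r c d) _)

  ∑²-transpose : (r : Fin n → Fin n → ℕ) → ∑² (λ c d → r d c) ≡ ∑² r
  ∑²-transpose r = ∑-comm (λ c d → r d c)

  ∑²-≥-pair : (r : Fin n → Fin n → ℕ) {c₁ c₂ : Fin n} (d₁ d₂ : Fin n) → c₁ ≢ c₂ → r c₁ d₁ + r c₂ d₂ ≤ ∑² r
  ∑²-≥-pair r d₁ d₂ c₁≢c₂ = ≤-trans (+-mono-≤ (∑-≥ (r _) d₁) (∑-≥ (r _) d₂)) (∑-≥-pair (λ c → ∑[ d < n ] r c d) c₁≢c₂)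

  ∑²-row : (x : Fin n) (p : Fin n → Bool) → ∑² (λ c d → 𝟙 ((c == x) ∧ p d)) ≡ ∑[ d < n ] 𝟙 (p d)
  ∑²-row x p = trans (∑-only _ x off-row) (sum-cong-≗ (λ d → cong (λ b → 𝟙 (b ∧ p d)) (==-refl x)))
    where
    off-row : ∀ c → c ≢ x → ∑[ d < n ] 𝟙 ((c == x) ∧ p d) ≡ 0
    off-row c c≢x rewrite ≢⇒==false c≢x = sum-replicate-zero n

  ∑²-𝟙-point : (p q : Fin n) → ∑² (λ c d → 𝟙 ((c == p) ∧ (d == q))) ≡ 1
  ∑²-𝟙-point p q = trans (∑²-row p (_== q)) (∑-𝟙-== q)

  ∑²-upper+lower : (r : Fin n → Fin n → ℕ) → (∀ c d → r c d ≡ r d c) → (∀ c → r c c ≡ 0) →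
                   ∑² (λ c d → if ⌊ c <? d ⌋ then r c d else 0) + ∑² (λ c d → if ⌊ c <? d ⌋ then r c d else 0) ≡ ∑² r
  ∑²-upper+lower r r-sym r-diag = begin
    upper + upper          ≡⟨ cong (upper +_) (trans (sym (∑²-transpose _)) (∑²-cong λ c d → cong (if ⌊ d <? c ⌋ then_else 0) (r-sym d c))) ⟩
    upper + lower          ≡⟨ ∑²-distrib-+ _ _ ⟨
    ∑² (λ c d → (if ⌊ c <? d ⌋ then r c d else 0) + (if ⌊ d <? c ⌋ then r c d else 0)) ≡⟨ ∑²-cong split ⟨
    ∑² r                   ∎
    where
    open ≡-Reasoning
    upper lower : ℕ
    upper = ∑² (λ c d → if ⌊ c <? d ⌋ then r c d else 0)
    lower = ∑² (λ c d → if ⌊ d <? c ⌋ then r c d else 0)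
    split : ∀ c d → r c d ≡ (if ⌊ c <? d ⌋ then r c d else 0) + (if ⌊ d <? c ⌋ then r c d else 0)
    split c d with c <? d | d <? c
    ... | yes c<d | yes d<c = ⊥-elim (<-asym c<d d<c)
    ... | yes _   | no _    = sym (+-comm (r c d) 0)
    ... | no _    | yes _   = refl
    ... | no c≮d  | no d≮c with <-cmp c d
    ...   | tri< c<d _ _    = ⊥-elim (c≮d c<d)
    ...   | tri> _ _ d<c    = ⊥-elim (d≮c d<c)
    ...   | tri≈ _ refl _   = r-diag c

𝟙-split : ∀ {a b} → (a ≡ true → b ≡ true) → 𝟙 b ≡ 𝟙 a + 𝟙 (b ∧ not a)
𝟙-split {true}  a⇒b rewrite a⇒b refl = refl
𝟙-split {false} {b} _ = cong 𝟙 (sym (∧-identityʳ b))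

module _ {n : ℕ} where

  ∑²-𝟙-gap : (r s : Fin n → Fin n → Bool) → (∀ {c d} → r c d ≡ true → s c d ≡ true) →
             ∀ {c₁ c₂ d₁ d₂} → c₁ ≢ c₂ → r c₁ d₁ ≡ false → s c₁ d₁ ≡ true → r c₂ d₂ ≡ false → s c₂ d₂ ≡ true →
             ∑² (λ c d → 𝟙 (r c d)) + 2 ≤ ∑² (λ c d → 𝟙 (s c d))
  ∑²-𝟙-gap r s r⊆s {c₁} {c₂} {d₁} {d₂} c₁≢c₂ r₁ s₁ r₂ s₂ = begin
    ∑² (λ c d → 𝟙 (r c d)) + 2                                          ≤⟨ +-monoʳ-≤ (∑² (λ c d → 𝟙 (r c d))) two-new ⟩
    ∑² (λ c d → 𝟙 (r c d)) + ∑² (λ c d → 𝟙 (s c d ∧ not (r c d)))     ≡⟨ ∑²-distrib-+ (λ c d → 𝟙 (r c d)) _ ⟨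
    ∑² (λ c d → 𝟙 (r c d) + 𝟙 (s c d ∧ not (r c d)))                   ≡⟨ ∑²-cong (λ c d → 𝟙-split (r⊆s {c} {d})) ⟨
    ∑² (λ c d → 𝟙 (s c d))                                               ∎
    where
    open Data.Nat.Properties.≤-Reasoning
    two-new : 2 ≤ ∑² (λ c d → 𝟙 (s c d ∧ not (r c d)))
    two-new with ∑²-≥-pair (λ c d → 𝟙 (s c d ∧ not (r c d))) d₁ d₂ c₁≢c₂
    ... | pair≤ rewrite r₁ | s₁ | r₂ | s₂ = pair≤

module _ {N : ℕ} where

  nbr-intro : ∀ (G : Graph N) {x c} → V G c ≡ true → adj G x c ≡ true → x ≢ c → nbr G x c ≡ true
  nbr-intro G Vc xc x≢c rewrite Vc | xc | ≢⇒==false x≢c = refl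

  nbr⇒V : ∀ (G : Graph N) {x c} → nbr G x c ≡ true → V G c ≡ true
  nbr⇒V G {x} {c} = ∧-elimˡ (V G c)

  nbr⇒adj : ∀ (G : Graph N) {x c} → nbr G x c ≡ true → adj G x c ≡ true
  nbr⇒adj G {x} {c} h = ∧-elimˡ (adj G x c) (∧-elimʳ (V G c) h)

  nbr⇒≢ : ∀ (G : Graph N) {x c} → nbr G x c ≡ true → x ≢ c
  nbr⇒≢ G {x} {c} h = ==false⇒≢ (not-elim (∧-elimʳ (adj G x c) (∧-elimʳ (V G c) h)))

  V-elim-intro : ∀ (G : Graph N) {x y} → V G y ≡ true → y ≢ x → V (elim G x) y ≡ true
  V-elim-intro G Vy y≢x rewrite Vy | ≢⇒==false y≢x = refl

  V-elim⇒V : ∀ (G : Graph N) {x y} → V (elim G x) y ≡ true → V G y ≡ true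
  V-elim⇒V G {x} {y} = ∧-elimˡ (V G y)

  V-elim⇒≢ : ∀ (G : Graph N) {x y} → V (elim G x) y ≡ true → y ≢ x
  V-elim⇒≢ G {x} {y} h = ==false⇒≢ (not-elim (∧-elimʳ (V G y) h))

  elim-keeps-adj : ∀ (G : Graph N) {x c d} → adj G c d ≡ true →
                   V (elim G x) c ≡ true → V (elim G x) d ≡ true → adj (elim G x) c d ≡ true
  elim-keeps-adj G cd Vc Vd rewrite cd | Vc | Vd = refl

  elim-fills : ∀ (G : Graph N) {x c d} → nbr G x c ≡ true → nbr G x d ≡ true → c ≢ d → adj (elim G x) c d ≡ true
  elim-fills G xc xd c≢d rewrite xc | xd | ≢⇒==false c≢d = ∨-zeroʳ _

  nbr-elim-self : ∀ (H : Graph N) → IsSimpleGraph H → ∀ a c → nbr (elim H a) a c ≡ false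
  nbr-elim-self H H-simple a c rewrite ==-refl a | IsSimpleGraph.irrefl H-simple a =
    not-elim (shape (V H c ∧ not (c == a)) (adj H a c) (V H a) (not (a == c)) (nbr H a c) (not (a == c)))
    where
    shape : ∀ Vc′ ac Va Z X Y → not (Vc′ ∧ ((ac ∧ (Va ∧ false) ∧ Vc′) ∨ ((Va ∧ false ∧ false) ∧ X ∧ Y)) ∧ Z) ≡ true
    shape = all-true-sound 6 _ refl

  nbr-elim⁻ : ∀ (H : Graph N) {x a c} → nbr (elim H x) a c ≡ true →
              (nbr H a c ≡ true × c ≢ x) ⊎ (nbr H x a ≡ true × nbr H x c ≡ true)
  nbr-elim⁻ H {x} {a} {c} h with ∨-elim (adj H a c ∧ V (elim H x) a ∧ V (elim H x) c) (nbr⇒adj (elim H x) h)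
  ... | inj₁ kept = inj₁ (nbr-intro H (V-elim⇒V H Vc′) (∧-elimˡ (adj H a c) kept) (nbr⇒≢ (elim H x) h) , V-elim⇒≢ H Vc′)
    where Vc′ = nbr⇒V (elim H x) h
  ... | inj₂ filled = inj₂ (∧-elimˡ (nbr H x a) filled , ∧-elimˡ (nbr H x c) (∧-elimʳ (nbr H x a) filled))

module _ {N : ℕ} {G : Graph N} (G-simple : IsSimpleGraph G) where

  open IsSimpleGraph G-simple renaming (sym to adj-sym)

  adj⇒V : ∀ {x y} → adj G x y ≡ true → V G x ≡ true
  adj⇒V = inV _ _

  adj⇒Vʳ : ∀ {x y} → adj G x y ≡ true → V G y ≡ true
  adj⇒Vʳ {x} {y} h = inV y x (trans (adj-sym y x) h)

  adj⇒≢ : ∀ {x y} → adj G x y ≡ true → x ≢ y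
  adj⇒≢ {x} h refl with () ← trans (sym h) (irrefl x)

  nbr-sym : ∀ {x c} → nbr G x c ≡ true → nbr G c x ≡ true
  nbr-sym {x} {c} h = nbr-intro G (adj⇒V (nbr⇒adj G h)) (trans (adj-sym c x) (nbr⇒adj G h)) (λ c≡x → nbr⇒≢ G h (sym c≡x))

  adj⇒ᵇV : ∀ c d → (adj G c d ⇒ᵇ V G c) ≡ true
  adj⇒ᵇV c d = ⇒ᵇ-intro (adj G c d) adj⇒V

  adj⇒ᵇVʳ : ∀ c d → (adj G c d ⇒ᵇ V G d) ≡ true
  adj⇒ᵇVʳ c d = ⇒ᵇ-intro (adj G c d) adj⇒Vʳ

  ==⇒ᵇ¬adj : ∀ y z w → adj G w z ≡ false → (y == z ⇒ᵇ not (adj G w y)) ≡ true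
  ==⇒ᵇ¬adj y z w wz = ⇒ᵇ-intro (y == z) (λ y=z → cong not (trans (cong (adj G w) (==⇒≡ y=z)) wz))

  elim-isSimple : ∀ x → IsSimpleGraph (elim G x)
  elim-isSimple x = record { sym = elim-sym ; irrefl = elim-irrefl ; inV = elim-inV }
    where
    elim-sym : ∀ c d → adj (elim G x) c d ≡ adj (elim G x) d c
    elim-sym c d rewrite adj-sym c d | ==-sym c d = ⇔ᵇ-elim (shape (adj G d c) (V (elim G x) c) (V (elim G x) d) (nbr G x c) (nbr G x d) (not (d == c)))
      where
      shape : ∀ A B C D E F → (A ∧ B ∧ C ∨ D ∧ E ∧ F ⇔ᵇ A ∧ C ∧ B ∨ E ∧ D ∧ F) ≡ true
      shape = all-true-sound 6 _ refl
    elim-irrefl : ∀ c → adj (elim G x) c c ≡ false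
    elim-irrefl c rewrite irrefl c | ==-refl c = not-elim (shape (nbr G x c) (nbr G x c))
      where
      shape : ∀ A B → not (A ∧ B ∧ false) ≡ true
      shape = all-true-sound 2 _ refl
    elim-inV : ∀ c d → adj (elim G x) c d ≡ true → V (elim G x) c ≡ true
    elim-inV c d h rewrite ==-sym x c | ==-sym x d =
      shape (adj G c d) (V G c) (c == x) (V G d) (d == x) (adj G x c) (adj G x d) (c == d) ∵ h
      where
      shape : ∀ A Vc cx Vd dx axc axd cd →
              ((A ∧ (Vc ∧ not cx) ∧ (Vd ∧ not dx)) ∨ ((Vc ∧ axc ∧ not cx) ∧ (Vd ∧ axd ∧ not dx) ∧ not cd) ⇒ᵇ Vc ∧ not cx) ≡ true
      shape = all-true-sound 8 _ refl

module _ {N : ℕ} where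

  record _≈ᴳ_ (G H : Graph N) : Set where
    field
      V-eq   : ∀ x → V G x ≡ V H x
      adj-eq : ∀ c d → adj G c d ≡ adj H c d
  open _≈ᴳ_ public

  ≈ᴳ-sym : ∀ {G H} → G ≈ᴳ H → H ≈ᴳ G
  ≈ᴳ-sym G≈H = record { V-eq = λ x → sym (V-eq G≈H x) ; adj-eq = λ c d → sym (adj-eq G≈H c d) }

  ≈ᴳ-trans : ∀ {G H K} → G ≈ᴳ H → H ≈ᴳ K → G ≈ᴳ K
  ≈ᴳ-trans G≈H H≈K = record { V-eq = λ x → trans (V-eq G≈H x) (V-eq H≈K x)
                            ; adj-eq = λ c d → trans (adj-eq G≈H c d) (adj-eq H≈K c d) }

  elim-cong : ∀ {G H} → G ≈ᴳ H → ∀ x → elim G x ≈ᴳ elim H x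
  elim-cong {G} {H} G≈H x = record { V-eq = λ y → cong (λ b → b ∧ not (y == x)) (V-eq G≈H y) ; adj-eq = adj-eq′ }
    where
    adj-eq′ : ∀ c d → adj (elim G x) c d ≡ adj (elim H x) c d
    adj-eq′ c d rewrite V-eq G≈H c | V-eq G≈H d | adj-eq G≈H c d | adj-eq G≈H x c | adj-eq G≈H x d = refl

  -- Doubled counts: fill pairs and edges are counted as ordered pairs, avoiding the c < d of `deficiency`.
  fillPair : Graph N → Fin N → Fin N → Fin N → Bool
  fillPair G x c d = nbr G x c ∧ nbr G x d ∧ not (adj G c d) ∧ not (c == d)

  fillPair-intro : ∀ (G : Graph N) {x c d} → nbr G x c ≡ true → nbr G x d ≡ true → adj G c d ≡ false → c ≢ d →
                   fillPair G x c d ≡ true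
  fillPair-intro G xc xd cd c≢d rewrite xc | xd | cd | ≢⇒==false c≢d = refl

  fillPair-elim : ∀ (G : Graph N) {x c d} → fillPair G x c d ≡ true →
                  nbr G x c ≡ true × nbr G x d ≡ true × adj G c d ≡ false × c ≢ d
  fillPair-elim G {x} {c} {d} h =
    ∧-elimˡ (nbr G x c) h , ∧-elimˡ (nbr G x d) h₁ , not-elim (∧-elimˡ (not (adj G c d)) h₂) ,
    ==false⇒≢ (not-elim (∧-elimʳ (not (adj G c d)) h₂))
    where
    h₁ = ∧-elimʳ (nbr G x c) h
    h₂ = ∧-elimʳ (nbr G x d) h₁

  deficiency₂ : Graph N → Fin N → ℕ
  deficiency₂ G x = ∑² (λ c d → 𝟙 (fillPair G x c d))

  fillIn₂ : Graph N → List (Fin N) → ℕ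
  fillIn₂ G []      = 0
  fillIn₂ G (x ∷ σ) = deficiency₂ G x + fillIn₂ (elim G x) σ

  edges₂ : Graph N → ℕ
  edges₂ G = ∑² (λ c d → 𝟙 (adj G c d))

  degree : Graph N → Fin N → ℕ
  degree G x = ∑[ d < N ] 𝟙 (nbr G x d)

  fillPair-cong : ∀ {G H} → G ≈ᴳ H → ∀ x c d → fillPair G x c d ≡ fillPair H x c d
  fillPair-cong G≈H x c d rewrite V-eq G≈H c | V-eq G≈H d | adj-eq G≈H x c | adj-eq G≈H x d | adj-eq G≈H c d = refl

  fillIn₂-cong : ∀ {G H} → G ≈ᴳ H → ∀ σ → fillIn₂ G σ ≡ fillIn₂ H σ
  fillIn₂-cong G≈H []      = refl
  fillIn₂-cong G≈H (x ∷ σ) = cong₂ _+_ (∑²-cong (λ c d → cong 𝟙 (fillPair-cong G≈H x c d))) (fillIn₂-cong (elim-cong G≈H x) σ)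

  deficiency₂≡ : ∀ {G} → IsSimpleGraph G → ∀ x → deficiency₂ G x ≡ 2 * deficiency G x
  deficiency₂≡ {G} G-simple x = begin
    deficiency₂ G x                  ≡⟨ ∑²-upper+lower (λ c d → 𝟙 (fillPair G x c d)) fillPair-sym fillPair-diag ⟨
    upper + upper                    ≡⟨ cong₂ _+_ deficiency≡upper (trans (+-identityʳ _) deficiency≡upper) ⟨
    deficiency G x + (deficiency G x + 0) ∎
    where
    open ≡-Reasoning
    upper : ℕ
    upper = ∑² (λ c d → if ⌊ c <? d ⌋ then 𝟙 (fillPair G x c d) else 0)
    upper-entry : ∀ c d → 𝟙 (⌊ c <? d ⌋ ∧ nbr G x c ∧ nbr G x d ∧ not (adj G c d)) ≡ (if ⌊ c <? d ⌋ then 𝟙 (fillPair G x c d) else 0)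
    upper-entry c d with c <? d
    ... | no _    = refl
    ... | yes c<d rewrite ≢⇒==false (λ c≡d → <-irrefl c≡d c<d) | ∧-identityʳ (not (adj G c d)) = refl
    deficiency≡upper : deficiency G x ≡ upper
    deficiency≡upper = trans (sum-map-allFin N _) (sum-cong-≗ λ c → trans (sum-map-allFin N _) (sum-cong-≗ (upper-entry c)))
    fillPair-sym : ∀ c d → 𝟙 (fillPair G x c d) ≡ 𝟙 (fillPair G x d c)
    fillPair-sym c d rewrite IsSimpleGraph.sym G-simple c d | ==-sym c d = cong 𝟙 (⇔ᵇ-elim (shape (nbr G x c) (nbr G x d) (not (adj G d c)) (not (d == c))))
      where
      shape : ∀ A B C D → (A ∧ B ∧ C ∧ D ⇔ᵇ B ∧ A ∧ C ∧ D) ≡ true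
      shape = all-true-sound 4 _ refl
    fillPair-diag : ∀ c → 𝟙 (fillPair G x c c) ≡ 0
    fillPair-diag c rewrite ==-refl c = cong 𝟙 (not-elim (shape (nbr G x c) (nbr G x c) (not (adj G c c))))
      where
      shape : ∀ A B C → not (A ∧ B ∧ C ∧ false) ≡ true
      shape = all-true-sound 3 _ refl

  fillIn₂≡ : ∀ {G} → IsSimpleGraph G → ∀ σ → fillIn₂ G σ ≡ 2 * fillIn G σ
  fillIn₂≡ G-simple []      = refl
  fillIn₂≡ {G} G-simple (x ∷ σ) = begin
    deficiency₂ G x + fillIn₂ (elim G x) σ         ≡⟨ cong₂ _+_ (deficiency₂≡ G-simple x) (fillIn₂≡ (elim-isSimple G-simple x) σ) ⟩
    2 * deficiency G x + 2 * fillIn (elim G x) σ   ≡⟨ *-distribˡ-+ 2 (deficiency G x) _ ⟨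
    2 * fillIn G (x ∷ σ)                           ∎
    where open ≡-Reasoning

  edges₂-elim : ∀ {G} → IsSimpleGraph G → ∀ x → edges₂ G + deficiency₂ G x ≡ edges₂ (elim G x) + 2 * degree G x
  edges₂-elim {G} G-simple x = begin
    edges₂ G + deficiency₂ G x
      ≡⟨ ∑²-distrib-+ (λ c d → 𝟙 (adj G c d)) (λ c d → 𝟙 (fillPair G x c d)) ⟨
    ∑² (λ c d → 𝟙 (adj G c d) + 𝟙 (fillPair G x c d))
      ≡⟨ ∑²-cong entry ⟩
    ∑² (λ c d → 𝟙 (adj (elim G x) c d) + (row c d + row d c))
      ≡⟨ ∑²-distrib-+ (λ c d → 𝟙 (adj (elim G x) c d)) (λ c d → row c d + row d c) ⟩
    edges₂ (elim G x) + ∑² (λ c d → row c d + row d c)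
      ≡⟨ cong (edges₂ (elim G x) +_) (∑²-distrib-+ row (λ c d → row d c)) ⟩
    edges₂ (elim G x) + (∑² row + ∑² (λ c d → row d c))
      ≡⟨ cong (edges₂ (elim G x) +_) (cong₂ _+_ (∑²-row x (nbr G x)) (trans (∑²-transpose row) (∑²-row x (nbr G x)))) ⟩
    edges₂ (elim G x) + (degree G x + degree G x)
      ≡⟨ cong (λ t → edges₂ (elim G x) + (degree G x + t)) (+-identityʳ _) ⟨
    edges₂ (elim G x) + 2 * degree G x
      ∎
    where
    open ≡-Reasoning
    open IsSimpleGraph G-simple renaming (sym to adj-sym)
    row : Fin N → Fin N → ℕ
    row c d = 𝟙 ((c == x) ∧ nbr G x d)
    -- an edge of G_x is an edge of G avoiding x or a fill pair of x; the edges of G at x are lost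
    counting : ∀ A Vc Vd axc axd cx dx cd →
      let nc = Vc ∧ axc ∧ not cx ; nd = Vd ∧ axd ∧ not dx in
      (A ⇒ᵇ Vc) ⇒ᵇ (A ⇒ᵇ Vd) ⇒ᵇ (axc ⇒ᵇ Vc) ⇒ᵇ (axd ⇒ᵇ Vd) ⇒ᵇ (cx ⇒ᵇ not axc) ⇒ᵇ (dx ⇒ᵇ not axd) ⇒ᵇ
      (cx ⇒ᵇ (A ⇔ᵇ axd)) ⇒ᵇ (dx ⇒ᵇ (A ⇔ᵇ axc)) ⇒ᵇ (cd ⇒ᵇ not A) ⇒ᵇ
      (cd ⇒ᵇ cx ⇒ᵇ dx) ⇒ᵇ (cd ⇒ᵇ dx ⇒ᵇ cx) ⇒ᵇ (cx ⇒ᵇ dx ⇒ᵇ cd) ⇒ᵇ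
      (𝟙 A + 𝟙 (nc ∧ nd ∧ not A ∧ not cd)
        ≡ᵇ 𝟙 (A ∧ (Vc ∧ not cx) ∧ (Vd ∧ not dx) ∨ nc ∧ nd ∧ not cd) + (𝟙 (cx ∧ nd) + 𝟙 (dx ∧ nc))) ≡ true
    counting = all-true-sound 8 _ refl
    entry : ∀ c d → 𝟙 (adj G c d) + 𝟙 (fillPair G x c d)
                  ≡ 𝟙 (adj (elim G x) c d) + (row c d + row d c)
    entry c d rewrite ==-sym x c | ==-sym x d = ≡ᵇ-true⇒≡ (
      counting (adj G c d) (V G c) (V G d) (adj G x c) (adj G x d) (c == x) (d == x) (c == d)
        ∵ adj⇒ᵇV G-simple c d ∵ adj⇒ᵇVʳ G-simple c d ∵ adj⇒ᵇVʳ G-simple x c ∵ adj⇒ᵇVʳ G-simple x d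
        ∵ ==⇒ᵇ¬adj G-simple c x x (irrefl x) ∵ ==⇒ᵇ¬adj G-simple d x x (irrefl x)
        ∵ ⇒ᵇ-intro (c == x) (λ c=x → ⇔ᵇ-intro (cong (λ z → adj G z d) (==⇒≡ c=x)))
        ∵ ⇒ᵇ-intro (d == x) (λ d=x → ⇔ᵇ-intro (trans (cong (adj G c) (==⇒≡ d=x)) (adj-sym c x)))
        ∵ ⇒ᵇ-intro (c == d) (λ c=d → cong not (trans (cong (adj G c) (sym (==⇒≡ c=d))) (irrefl c)))
        ∵ ⇒ᵇ-intro (c == d) (λ c=d → ⇒ᵇ-intro (c == x) (λ c=x → trans (cong (_== x) (sym (==⇒≡ c=d))) c=x))
        ∵ ⇒ᵇ-intro (c == d) (λ c=d → ⇒ᵇ-intro (d == x) (λ d=x → trans (cong (_== x) (==⇒≡ c=d)) d=x))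
        ∵ ⇒ᵇ-intro (c == x) (λ c=x → ⇒ᵇ-intro (d == x) (λ d=x → trans (cong (c ==_) (trans (==⇒≡ d=x) (sym (==⇒≡ c=x)))) (==-refl c))))

-- Subgraphs

module _ {N : ℕ} where

  record _⊆ᴳ_ (G H : Graph N) : Set where
    field
      V-eq : ∀ x → V G x ≡ V H x
      adj⊆ : ∀ {c d} → adj G c d ≡ true → adj H c d ≡ true
  open _⊆ᴳ_ public

  nbr-mono : ∀ {G H} → G ⊆ᴳ H → ∀ {x c} → nbr G x c ≡ true → nbr H x c ≡ true
  nbr-mono {G} {H} G⊆H {x} {c} h =
    nbr-intro H (trans (sym (V-eq G⊆H c)) (nbr⇒V G h)) (adj⊆ G⊆H (nbr⇒adj G h)) (nbr⇒≢ G h)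

  degree-mono : ∀ {G H} → G ⊆ᴳ H → ∀ x → degree G x ≤ degree H x
  degree-mono G⊆H x = ∑-mono-≤ {N} (λ d → 𝟙-mono (nbr-mono G⊆H))

  elim-mono : ∀ {G H} → G ⊆ᴳ H → ∀ x → elim G x ⊆ᴳ elim H x
  elim-mono {G} {H} G⊆H x = record { V-eq = λ y → cong (λ b → b ∧ not (y == x)) (V-eq G⊆H y) ; adj⊆ = adj⊆′ }
    where
    shape : ∀ AG AH B₁ B₂ Vc Vd xcG xcH xdG xdH nxc nxd ncd →
            (AG ⇒ᵇ AH) ⇒ᵇ (xcG ⇒ᵇ xcH) ⇒ᵇ (xdG ⇒ᵇ xdH) ⇒ᵇ
            AG ∧ B₁ ∧ B₂ ∨ (Vc ∧ xcG ∧ nxc) ∧ (Vd ∧ xdG ∧ nxd) ∧ ncd ⇒ᵇ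
            AH ∧ B₁ ∧ B₂ ∨ (Vc ∧ xcH ∧ nxc) ∧ (Vd ∧ xdH ∧ nxd) ∧ ncd ≡ true
    shape = all-true-sound 13 _ refl
    adj⊆′ : ∀ {c d} → adj (elim G x) c d ≡ true → adj (elim H x) c d ≡ true
    adj⊆′ {c} {d} h rewrite V-eq G⊆H c | V-eq G⊆H d =
      shape (adj G c d) (adj H c d) (V H c ∧ not (c == x)) (V H d ∧ not (d == x)) (V H c) (V H d)
            (adj G x c) (adj H x c) (adj G x d) (adj H x d) (not (x == c)) (not (x == d)) (not (c == d))
        ∵ ⇒ᵇ-intro (adj G c d) (adj⊆ G⊆H) ∵ ⇒ᵇ-intro (adj G x c) (adj⊆ G⊆H) ∵ ⇒ᵇ-intro (adj G x d) (adj⊆ G⊆H) ∵ h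

  -- edges₂ G + fillIn₂ G σ is the doubled edge count of the graph filled along σ
  edges₂+fillIn₂-mono : ∀ {G H} → IsSimpleGraph G → IsSimpleGraph H → G ⊆ᴳ H → ∀ σ →
                        edges₂ G + fillIn₂ G σ ≤ edges₂ H + fillIn₂ H σ
  edges₂+fillIn₂-mono G-simple H-simple G⊆H [] =
    +-mono-≤ (∑²-mono-≤ {N} (λ c d → 𝟙-mono (adj⊆ G⊆H))) z≤n
  edges₂+fillIn₂-mono {G} {H} G-simple H-simple G⊆H (x ∷ σ) = begin
    edges₂ G + (deficiency₂ G x + fillIn₂ (elim G x) σ)               ≡⟨ eliminate G-simple ⟩
    (edges₂ (elim G x) + fillIn₂ (elim G x) σ) + 2 * degree G x       ≤⟨ +-mono-≤ IH (*-monoʳ-≤ 2 (degree-mono G⊆H x)) ⟩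
    (edges₂ (elim H x) + fillIn₂ (elim H x) σ) + 2 * degree H x       ≡⟨ eliminate H-simple ⟨
    edges₂ H + (deficiency₂ H x + fillIn₂ (elim H x) σ)               ∎
    where
    open Data.Nat.Properties.≤-Reasoning
    IH = edges₂+fillIn₂-mono (elim-isSimple G-simple x) (elim-isSimple H-simple x) (elim-mono G⊆H x) σ
    eliminate : ∀ {K} → IsSimpleGraph K →
                edges₂ K + (deficiency₂ K x + fillIn₂ (elim K x) σ) ≡ (edges₂ (elim K x) + fillIn₂ (elim K x) σ) + 2 * degree K x
    eliminate {K} K-simple = begin-equality
      edges₂ K + (deficiency₂ K x + fillIn₂ (elim K x) σ)          ≡⟨ +-assoc (edges₂ K) _ _ ⟨
      (edges₂ K + deficiency₂ K x) + fillIn₂ (elim K x) σ          ≡⟨ cong (_+ fillIn₂ (elim K x) σ) (edges₂-elim K-simple x) ⟩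
      (edges₂ (elim K x) + 2 * degree K x) + fillIn₂ (elim K x) σ  ≡⟨ xy∙z≈xz∙y (edges₂ (elim K x)) _ _ ⟩
      (edges₂ (elim K x) + fillIn₂ (elim K x) σ) + 2 * degree K x  ∎

-- Simplicial vertices

module _ {N : ℕ} where

  delete : Graph N → Fin N → Graph N
  delete H a = mkGraph (λ y → V H y ∧ not (y == a)) (λ c d → adj H c d ∧ not (c == a) ∧ not (d == a))

  without : Fin N → List (Fin N) → List (Fin N)
  without a = filter (λ y → ¬? (y ≟ a))

  IsSimplicial : Graph N → Fin N → Set
  IsSimplicial H a = ∀ c d → nbr H a c ≡ true → nbr H a d ≡ true → c ≢ d → adj H c d ≡ true

  delete-cong : ∀ {G H} → G ≈ᴳ H → ∀ a → delete G a ≈ᴳ delete H a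
  delete-cong G≈H a = record { V-eq = λ y → cong (λ b → b ∧ not (y == a)) (V-eq G≈H y)
                             ; adj-eq = λ c d → cong (λ b → b ∧ not (c == a) ∧ not (d == a)) (adj-eq G≈H c d) }

  delete-idem : ∀ H a → delete (delete H a) a ≈ᴳ delete H a
  delete-idem H a = record { V-eq = λ y → ⇔ᵇ-elim (V-shape (V H y) (y == a))
                           ; adj-eq = λ c d → ⇔ᵇ-elim (adj-shape (adj H c d) (c == a) (d == a)) }
    where
    V-shape : ∀ Vy ya → ((Vy ∧ not ya) ∧ not ya ⇔ᵇ Vy ∧ not ya) ≡ true
    V-shape = all-true-sound 2 _ refl
    adj-shape : ∀ A ca da → ((A ∧ not ca ∧ not da) ∧ not ca ∧ not da ⇔ᵇ A ∧ not ca ∧ not da) ≡ true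
    adj-shape = all-true-sound 3 _ refl

  elim≈delete : ∀ {H a} → IsSimpleGraph H → IsSimplicial H a → elim H a ≈ᴳ delete H a
  elim≈delete {H} {a} H-simple a-simplicial = record { V-eq = λ y → refl ; adj-eq = adj-eq′ }
    where
    shape : ∀ A Vc Vd ca da nac nad ncd →
            (nac ∧ nad ∧ ncd ⇒ᵇ A) ⇒ᵇ (A ⇒ᵇ Vc) ⇒ᵇ (A ⇒ᵇ Vd) ⇒ᵇ (nac ⇒ᵇ not ca) ⇒ᵇ (nad ⇒ᵇ not da) ⇒ᵇ
            (A ∧ (Vc ∧ not ca) ∧ (Vd ∧ not da) ∨ nac ∧ nad ∧ ncd ⇔ᵇ A ∧ not ca ∧ not da) ≡ true
    shape = all-true-sound 8 _ refl
    nbr⇒ᵇ≢ : ∀ c → (nbr H a c ⇒ᵇ not (c == a)) ≡ true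
    nbr⇒ᵇ≢ c = ⇒ᵇ-intro (nbr H a c) (λ ac → cong not (≢⇒==false (λ c≡a → nbr⇒≢ H ac (sym c≡a))))
    adj-eq′ : ∀ c d → adj (elim H a) c d ≡ adj (delete H a) c d
    adj-eq′ c d = ⇔ᵇ-elim (shape (adj H c d) (V H c) (V H d) (c == a) (d == a) (nbr H a c) (nbr H a d) (not (c == d))
      ∵ ⇒ᵇ-intro (nbr H a c ∧ nbr H a d ∧ not (c == d))
          (λ h → a-simplicial c d (∧-elimˡ (nbr H a c) h) (∧-elimˡ (nbr H a d) (∧-elimʳ (nbr H a c) h))
                                  (==false⇒≢ (not-elim (∧-elimʳ (nbr H a d) (∧-elimʳ (nbr H a c) h)))))
      ∵ adj⇒ᵇV H-simple c d ∵ adj⇒ᵇVʳ H-simple c d ∵ nbr⇒ᵇ≢ c ∵ nbr⇒ᵇ≢ d)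

  elim-delete-comm : ∀ H {a x} → x ≢ a → elim (delete H a) x ≈ᴳ delete (elim H x) a
  elim-delete-comm H {a} {x} x≢a = record { V-eq = λ y → ⇔ᵇ-elim (V-shape (V H y) (y == a) (y == x)) ; adj-eq = adj-eq′ }
    where
    V-shape : ∀ Vy ya yx → ((Vy ∧ not ya) ∧ not yx ⇔ᵇ (Vy ∧ not yx) ∧ not ya) ≡ true
    V-shape = all-true-sound 3 _ refl
    adj-shape : ∀ A Vc Vd ca da cx dx axc axd cd →
      ((A ∧ not ca ∧ not da) ∧ ((Vc ∧ not ca) ∧ not cx) ∧ ((Vd ∧ not da) ∧ not dx)
         ∨ ((Vc ∧ not ca) ∧ (axc ∧ not false ∧ not ca) ∧ not cx) ∧ ((Vd ∧ not da) ∧ (axd ∧ not false ∧ not da) ∧ not dx) ∧ not cd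
       ⇔ᵇ (A ∧ (Vc ∧ not cx) ∧ (Vd ∧ not dx) ∨ (Vc ∧ axc ∧ not cx) ∧ (Vd ∧ axd ∧ not dx) ∧ not cd) ∧ not ca ∧ not da) ≡ true
    adj-shape = all-true-sound 10 _ refl
    adj-eq′ : ∀ c d → adj (elim (delete H a) x) c d ≡ adj (delete (elim H x) a) c d
    adj-eq′ c d rewrite ≢⇒==false x≢a | ==-sym x c | ==-sym x d =
      ⇔ᵇ-elim (adj-shape (adj H c d) (V H c) (V H d) (c == a) (d == a) (c == x) (d == x) (adj H x c) (adj H x d) (c == d))

  fillPair-delete : ∀ H a x c d → fillPair (delete H a) x c d ≡ true → fillPair H x c d ≡ true
  fillPair-delete H a x c d = _∵_ (shape (V H c) (V H d) (adj H x c) (adj H x d) (c == a) (d == a) (x == a) (x == c) (x == d) (adj H c d) (c == d))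
    where
    shape : ∀ Vc Vd axc axd ca da xa xc xd A cd →
      ((Vc ∧ not ca) ∧ (axc ∧ not xa ∧ not ca) ∧ not xc) ∧ ((Vd ∧ not da) ∧ (axd ∧ not xa ∧ not da) ∧ not xd) ∧ not (A ∧ not ca ∧ not da) ∧ not cd
        ⇒ᵇ (Vc ∧ axc ∧ not xc) ∧ (Vd ∧ axd ∧ not xd) ∧ not A ∧ not cd ≡ true
    shape = all-true-sound 11 _ refl

  isSimplicial⇒nbr : ∀ {H a x y} → IsSimpleGraph H → IsSimplicial H a →
                     nbr H x a ≡ true → nbr H a y ≡ true → y ≢ x → nbr H x y ≡ true
  isSimplicial⇒nbr {H} {a} {x} {y} H-simple a-simplicial xa ay y≢x =
    nbr-intro H (nbr⇒V H ay) (a-simplicial x y (nbr-sym H-simple xa) ay (y≢x ∘ sym)) (y≢x ∘ sym)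

  isSimplicial-elim : ∀ {H a} → IsSimpleGraph H → IsSimplicial H a → ∀ x → IsSimplicial (elim H x) a
  isSimplicial-elim {H} {a} H-simple a-simplicial x c d ac ad c≢d with nbr-elim⁻ H {x} {a} {c} ac | nbr-elim⁻ H {x} {a} {d} ad
  ... | inj₁ (ac′ , c≢x) | inj₁ (ad′ , d≢x) =
    elim-keeps-adj H (a-simplicial c d ac′ ad′ c≢d) (V-elim-intro H (nbr⇒V H ac′) c≢x) (V-elim-intro H (nbr⇒V H ad′) d≢x)
  ... | inj₁ (ac′ , c≢x) | inj₂ (xa , xd) = elim-fills H {x} (isSimplicial⇒nbr {H} {a} {x} {c} H-simple a-simplicial xa ac′ c≢x) xd c≢d
  ... | inj₂ (xa , xc)   | inj₁ (ad′ , d≢x) = elim-fills H {x} xc (isSimplicial⇒nbr {H} {a} {x} {d} H-simple a-simplicial xa ad′ d≢x) c≢d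
  ... | inj₂ (_ , xc)    | inj₂ (_ , xd) = elim-fills H {x} xc xd c≢d

  fillIn₂-delete-simplicial : ∀ σ {H a} → IsSimpleGraph H → IsSimplicial H a → fillIn₂ (delete H a) (without a σ) ≤ fillIn₂ H σ
  fillIn₂-delete-simplicial []      _ _ = z≤n
  fillIn₂-delete-simplicial (x ∷ σ) {H} {a} H-simple a-simplicial with x ≟ a
  ... | yes refl = begin
    fillIn₂ (delete H x) (without x σ)             ≡⟨ fillIn₂-cong (≈ᴳ-trans (delete-cong (elim≈delete H-simple a-simplicial) x) (delete-idem H x)) (without x σ) ⟨
    fillIn₂ (delete (elim H x) x) (without x σ)    ≤⟨ fillIn₂-delete-simplicial σ (elim-isSimple H-simple x) isolated ⟩
    fillIn₂ (elim H x) σ                           ≤⟨ m≤n+m _ _ ⟩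
    deficiency₂ H x + fillIn₂ (elim H x) σ         ∎
    where
    open Data.Nat.Properties.≤-Reasoning
    isolated : IsSimplicial (elim H x) x
    isolated c d xc _ _ with () ← trans (sym xc) (nbr-elim-self H H-simple x c)
  ... | no x≢a = +-mono-≤ (∑²-mono-≤ {N} (λ c d → 𝟙-mono (fillPair-delete H a x c d)))
    (begin
      fillIn₂ (elim (delete H a) x) (without a σ)  ≡⟨ fillIn₂-cong (elim-delete-comm H x≢a) (without a σ) ⟩
      fillIn₂ (delete (elim H x) a) (without a σ)  ≤⟨ fillIn₂-delete-simplicial σ (elim-isSimple H-simple x) (isSimplicial-elim H-simple a-simplicial x) ⟩
      fillIn₂ (elim H x) σ                          ∎)
    where open Data.Nat.Properties.≤-Reasoning

module _ {N : ℕ} where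

  open Equivalence

  isOrdering-cong : ∀ {G H : Graph N} {σ} → (∀ y → V G y ≡ V H y) → IsOrdering G σ → IsOrdering H σ
  isOrdering-cong V-eq′ (unique , mem) =
    unique , λ y → mk⇔ (λ y∈σ → trans (sym (V-eq′ y)) (to (mem y) y∈σ))
                       (λ Vy → from (mem y) (trans (V-eq′ y) Vy))

  isOrdering-tail : ∀ {G : Graph N} {x σ} → IsOrdering G (x ∷ σ) → IsOrdering (elim G x) σ
  isOrdering-tail {G} {x} {σ} (x∉σ ∷ unique , mem) = unique , λ y → mk⇔ (in-V y) (in-σ y)
    where
    in-V : ∀ y → y ∈ σ → V (elim G x) y ≡ true
    in-V y y∈σ = V-elim-intro G (to (mem y) (there y∈σ)) (λ y≡x → All.lookup x∉σ y∈σ (sym y≡x))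
    in-σ : ∀ y → V (elim G x) y ≡ true → y ∈ σ
    in-σ y Vy with from (mem y) (V-elim⇒V G Vy)
    ... | here y≡x  = ⊥-elim (V-elim⇒≢ G Vy y≡x)
    ... | there y∈σ = y∈σ

  isOrdering-head : ∀ {G : Graph N} {x σ} → IsOrdering G (x ∷ σ) → V G x ≡ true
  isOrdering-head (_ , mem) = to (mem _) (here refl)

  isOrdering-∷ : ∀ {G : Graph N} {x ρ} → V G x ≡ true → IsOrdering (elim G x) ρ → IsOrdering G (x ∷ ρ)
  isOrdering-∷ {G} {x} {ρ} Vx (unique , mem) = All.tabulate x∉ρ ∷ unique , λ y → mk⇔ (in-V y) (in-ρ y)
    where
    x∉ρ : ∀ {y} → y ∈ ρ → x ≢ y
    x∉ρ {y} y∈ρ x≡y = V-elim⇒≢ G (to (mem y) y∈ρ) (sym x≡y)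
    in-V : ∀ y → y ∈ x ∷ ρ → V G y ≡ true
    in-V y (here refl)  = Vx
    in-V y (there y∈ρ)  = V-elim⇒V G (to (mem y) y∈ρ)
    in-ρ : ∀ y → V G y ≡ true → y ∈ x ∷ ρ
    in-ρ y Vy with y ≟ x
    ... | yes y≡x = here y≡x
    ... | no y≢x  = there (from (mem y) (V-elim-intro G Vy y≢x))

  isOrdering-without : ∀ {G : Graph N} {σ} a → IsOrdering G σ → IsOrdering (delete G a) (without a σ)
  isOrdering-without {G} {σ} a (unique , mem) = filter⁺ _ unique , λ y → mk⇔ (in-V y) (in-σ y)
    where
    in-V : ∀ y → y ∈ without a σ → V (delete G a) y ≡ true
    in-V y y∈ with ∈-filter⁻ _ y∈
    ... | y∈σ , y≢a = V-elim-intro G (to (mem y) y∈σ) y≢a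
    in-σ : ∀ y → V (delete G a) y ≡ true → y ∈ without a σ
    in-σ y Vy = ∈-filter⁺ _ (from (mem y) (V-elim⇒V G Vy)) (V-elim⇒≢ G Vy)

-- Relabelling by an involution

module Relabel {N : ℕ} (π : Fin N → Fin N) (π-involutive : ∀ i → π (π i) ≡ i) where

  relabel : Graph N → Graph N
  relabel G = mkGraph (V G ∘ π) (λ c d → adj G (π c) (π d))

  π-injective : ∀ {i j} → π i ≡ π j → i ≡ j
  π-injective {i} {j} πi≡πj = trans (sym (π-involutive i)) (trans (cong π πi≡πj) (π-involutive j))

  ==-π : ∀ x c → (π x == c) ≡ (x == π c)
  ==-π x c with x == π c in eq
  ... | true  = trans (cong (_== c) (trans (cong π (==⇒≡ eq)) (π-involutive c))) (==-refl c)
  ... | false = ≢⇒==false (λ πx≡c → ==false⇒≢ eq (trans (sym (π-involutive x)) (cong π πx≡c)))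

  ==-ππ : ∀ c d → (π c == π d) ≡ (c == d)
  ==-ππ c d = trans (==-π c (π d)) (cong (c ==_) (π-involutive d))

  ∑²-relabel : (r : Fin N → Fin N → ℕ) → ∑² (λ c d → r (π c) (π d)) ≡ ∑² r
  ∑²-relabel r = sym (trans (∑-permute _ π-perm) (sum-cong-≗ (λ c → ∑-permute (r (π c)) π-perm)))
    where
    π-perm : Permutation N N
    π-perm = permutation π π π-involutive π-involutive

  relabel-isSimple : ∀ {G} → IsSimpleGraph G → IsSimpleGraph (relabel G)
  relabel-isSimple G-simple = record
    { sym = λ x y → IsSimpleGraph.sym G-simple (π x) (π y)
    ; irrefl = λ x → IsSimpleGraph.irrefl G-simple (π x)
    ; inV = λ x y → IsSimpleGraph.inV G-simple (π x) (π y) }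

  relabel-involutive : ∀ G → relabel (relabel G) ≈ᴳ G
  relabel-involutive G = record { V-eq = λ y → cong (V G) (π-involutive y)
                                ; adj-eq = λ c d → cong₂ (adj G) (π-involutive c) (π-involutive d) }

  nbr-relabel : ∀ G x c → nbr (relabel G) (π x) c ≡ nbr G x (π c)
  nbr-relabel G x c = cong₂ (λ y b → V G (π c) ∧ adj G y (π c) ∧ not b) (π-involutive x) (==-π x c)

  fillPair-relabel : ∀ G x c d → fillPair (relabel G) (π x) c d ≡ fillPair G x (π c) (π d)
  fillPair-relabel G x c d rewrite nbr-relabel G x c | nbr-relabel G x d | ==-ππ c d = refl

  elim-relabel : ∀ G x → elim (relabel G) (π x) ≈ᴳ relabel (elim G x)
  elim-relabel G x = record { V-eq = λ y → cong (λ b → V G (π y) ∧ not b) (==-πʳ y) ; adj-eq = adj-eq′ }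
    where
    ==-πʳ : ∀ y → (y == π x) ≡ (π y == x)
    ==-πʳ y = trans (==-sym y (π x)) (trans (==-π x y) (==-sym x (π y)))
    adj-eq′ : ∀ c d → adj (elim (relabel G) (π x)) c d ≡ adj (relabel (elim G x)) c d
    adj-eq′ c d rewrite ==-πʳ c | ==-πʳ d | nbr-relabel G x c | nbr-relabel G x d | ==-ππ c d = refl

  edges₂-relabel : ∀ G → edges₂ (relabel G) ≡ edges₂ G
  edges₂-relabel G = ∑²-relabel (λ c d → 𝟙 (adj G c d))

  fillIn₂-relabel : ∀ σ G → fillIn₂ (relabel G) (map π σ) ≡ fillIn₂ G σ
  fillIn₂-relabel []      G = refl
  fillIn₂-relabel (x ∷ σ) G = cong₂ _+_
    (trans (∑²-cong (λ c d → cong 𝟙 (fillPair-relabel G x c d))) (∑²-relabel (λ c d → 𝟙 (fillPair G x c d))))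
    (trans (fillIn₂-cong (elim-relabel G x) (map π σ)) (fillIn₂-relabel σ (elim G x)))

  isOrdering-relabel : ∀ {G σ} → IsOrdering G σ → IsOrdering (relabel G) (map π σ)
  isOrdering-relabel {G} {σ} (unique , mem) = map⁺ π-injective unique , λ y → mk⇔ (in-V y) (in-σ y)
    where
    open Equivalence
    in-V : ∀ y → y ∈ map π σ → V G (π y) ≡ true
    in-V y y∈ with ∈-map⁻ π y∈
    ... | z , z∈σ , refl = to (mem (π (π z))) (subst (_∈ σ) (sym (π-involutive z)) z∈σ)
    in-σ : ∀ y → V G (π y) ≡ true → y ∈ map π σ
    in-σ y Vπy = subst (_∈ map π σ) (π-involutive y) (∈-map⁺ π (from (mem (π y)) Vπy))

module _ {N : ℕ} where

  swap : Fin N → Fin N → Fin N → Fin N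
  swap a u i = if i == a then u else if i == u then a else i

  module _ {a u : Fin N} (a≢u : a ≢ u) where

    swap-a : swap a u a ≡ u
    swap-a rewrite ==-refl a = refl

    swap-u : swap a u u ≡ a
    swap-u rewrite ≢⇒==false (a≢u ∘′ sym) | ==-refl u = refl

    swap-other : ∀ {i} → i ≢ a → i ≢ u → swap a u i ≡ i
    swap-other i≢a i≢u rewrite ≢⇒==false i≢a | ≢⇒==false i≢u = refl

    swap-involutive : ∀ i → swap a u (swap a u i) ≡ i
    swap-involutive i with i == a in i=a
    ... | true rewrite ==⇒≡ i=a = swap-u
    ... | false with i == u in i=u
    ...   | true rewrite ==⇒≡ i=u = swap-a
    ...   | false = swap-other (==false⇒≢ i=a) (==false⇒≢ i=u)

-- Separation cliques

module _ {N : ℕ} where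

  Outside : Graph N → Fin N → (Fin N → Bool) → Fin N → Bool
  Outside G a V₁ z = V G z ∧ not (singleton a z) ∧ not (V₁ z)

  outside-intro : ∀ (G : Graph N) a V₁ {z} → V G z ≡ true → z ≢ a → V₁ z ≡ false → Outside G a V₁ z ≡ true
  outside-intro G a V₁ Vz z≢a z∉V₁ rewrite Vz | ≢⇒==false z≢a | z∉V₁ = refl

  outside⇒V : ∀ (G : Graph N) a V₁ {z} → Outside G a V₁ z ≡ true → V G z ≡ true
  outside⇒V G a V₁ {z} = ∧-elimˡ (V G z)

  outside⇒≢ : ∀ (G : Graph N) a V₁ {z} → Outside G a V₁ z ≡ true → z ≢ a
  outside⇒≢ G a V₁ {z} h = ==false⇒≢ (not-elim (∧-elimˡ (not (z == a)) (∧-elimʳ (V G z) h)))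

  outside⇒∉ : ∀ (G : Graph N) a V₁ {z} → Outside G a V₁ z ≡ true → V₁ z ≡ false
  outside⇒∉ G a V₁ {z} h = not-elim (∧-elimʳ (not (z == a)) (∧-elimʳ (V G z) h))

  separation : ∀ {G a} (V₁ : Fin N → Bool) → V G a ≡ true →
               (∀ y → V₁ y ≡ true → (V G y ∧ not (singleton a y)) ≡ true) →
               ∃ (λ y → V₁ y ≡ true) → ∃ (λ z → Outside G a V₁ z ≡ true) →
               (∀ y z → V₁ y ≡ true → Outside G a V₁ z ≡ true → adj G y z ≡ false) →
               IsSeparationClique G (singleton a)
  separation {G} {a} V₁ Va inside ne₁ ne₂ no-edge = a-in-V , a-clique , V₁ , inside , ne₁ , ne₂ , no-edge
    where
    a-in-V : ∀ x → singleton a x ≡ true → V G x ≡ true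
    a-in-V x x=a rewrite ==⇒≡ x=a = Va
    a-clique : ∀ x y → singleton a x ≡ true → singleton a y ≡ true → x ≢ y → adj G x y ≡ true
    a-clique x y x=a y=a x≢y = contradiction (trans (==⇒≡ x=a) (sym (==⇒≡ y=a))) x≢y

  inside-intro : ∀ (G : Graph N) a {y} → V G y ≡ true → y ≢ a → (V G y ∧ not (singleton a y)) ≡ true
  inside-intro G a Vy y≢a rewrite Vy | ≢⇒==false y≢a = refl

  module _ {G : Graph N} (G-simple : IsSimpleGraph G) where

    ¬separation⇒nbr : ∀ {a u v : Fin N} → ¬ IsSeparationClique G (singleton a) →
                      adj G a u ≡ true → adj G a v ≡ true → u ≢ v → ∃ λ w → nbr G u w ≡ true × w ≢ a
    ¬separation⇒nbr {a} {u} {v} no-sep au av u≢v with any? (λ w → (nbr G u w ∧ not (w == a)) ≟ᵇ true)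
    ... | yes (w , uw) = w , ∧-elimˡ (nbr G u w) uw , ==false⇒≢ (not-elim (∧-elimʳ (nbr G u w) uw))
    ... | no no-other = contradiction (separation (_== u) (adj⇒V G-simple au) inside (u , ==-refl u)
                                  (v , outside-intro G a (_== u) (adj⇒Vʳ G-simple av) (adj⇒≢ G-simple av ∘′ sym) (≢⇒==false (u≢v ∘′ sym)))
                                  no-edge) no-sep
      where
      inside : ∀ y → (y == u) ≡ true → (V G y ∧ not (singleton a y)) ≡ true
      inside y y=u rewrite ==⇒≡ y=u = inside-intro G a {u} (adj⇒Vʳ G-simple au) (adj⇒≢ G-simple au ∘′ sym)
      no-edge : ∀ y z → (y == u) ≡ true → Outside G a (_== u) z ≡ true → adj G y z ≡ false
      no-edge y z y=u z-out with adj G y z in yz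
      ... | false = refl
      ... | true  = contradiction (z , ∧-intro (nbr-intro G (outside⇒V G a (_== u) z-out) (subst (λ t → adj G t z ≡ true) (==⇒≡ y=u) yz)
                                                   (λ u≡z → ==false⇒≢ (outside⇒∉ G a (_== u) z-out) (sym u≡z)))
                                       (cong not (≢⇒==false (outside⇒≢ G a (_== u) z-out)))) no-other

    module _ {x a : Fin N} (x≢a : x ≢ a) (Vx : V G x ≡ true) (V₁ : Fin N → Bool)
             (inside : ∀ y → V₁ y ≡ true → (V (elim G x) y ∧ not (singleton a y)) ≡ true)
             (no-edge : ∀ y z → V₁ y ≡ true → Outside (elim G x) a V₁ z ≡ true → adj (elim G x) y z ≡ false) where

      private
        inside-V : ∀ {y} → V₁ y ≡ true → V (elim G x) y ≡ true
        inside-V {y} y∈V₁ = ∧-elimˡ (V (elim G x) y) (inside y y∈V₁)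

        inside-≢ : ∀ {y} → V₁ y ≡ true → y ≢ a
        inside-≢ {y} y∈V₁ = ==false⇒≢ (not-elim (∧-elimʳ (V (elim G x) y) (inside y y∈V₁)))

        inside-G : ∀ y → V₁ y ≡ true → (V G y ∧ not (singleton a y)) ≡ true
        inside-G y y∈V₁ = inside-intro G a (V-elim⇒V G (inside-V y∈V₁)) (inside-≢ y∈V₁)

        outside-elim : ∀ {z} → V G z ≡ true → z ≢ x → z ≢ a → V₁ z ≡ false → Outside (elim G x) a V₁ z ≡ true
        outside-elim Vz z≢x = outside-intro (elim G x) a V₁ (V-elim-intro G Vz z≢x)

        no-edge-G : ∀ {y z} → V₁ y ≡ true → V G z ≡ true → z ≢ x → z ≢ a → V₁ z ≡ false → adj G y z ≡ false
        no-edge-G {y} {z} y∈V₁ Vz z≢x z≢a z∉V₁ with adj G y z in yz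
        ... | false = refl
        ... | true with () ← trans (sym (elim-keeps-adj G {x} yz (inside-V y∈V₁) (V-elim-intro G Vz z≢x)))
                                   (no-edge y z y∈V₁ (outside-elim Vz z≢x z≢a z∉V₁))

        V₁∪x : Fin N → Bool
        V₁∪x t = V₁ t ∨ (t == x)

        x-joins-V₁ : ∀ {w} → nbr G x w ≡ true → V₁ w ≡ true →
                     ∀ y z → V₁∪x y ≡ true → Outside G a V₁∪x z ≡ true → adj G y z ≡ false
        x-joins-V₁ {w} xw w∈V₁ y z y∈ z-out with adj G y z in yz
        ... | false = refl
        ... | true with ∨-false (V₁ z) (outside⇒∉ G a V₁∪x z-out) | ∨-elim (V₁ y) y∈
        ...   | z∉V₁ , z≠x | inj₁ y∈V₁ =
          trans (sym yz) (no-edge-G y∈V₁ (outside⇒V G a V₁∪x z-out) (==false⇒≢ z≠x) (outside⇒≢ G a V₁∪x z-out) z∉V₁)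
        ...   | z∉V₁ , z≠x | inj₂ y=x with () ←
          trans (sym (elim-fills G xw (nbr-intro G (outside⇒V G a V₁∪x z-out) (subst (λ t → adj G t z ≡ true) (==⇒≡ y=x) yz)
                                                  (λ x≡z → ==false⇒≢ z≠x (sym x≡z)))
                                      (λ { refl → true≢false (trans (sym w∈V₁) z∉V₁) })))
                (no-edge w z w∈V₁ (outside-elim (outside⇒V G a V₁∪x z-out) (==false⇒≢ z≠x) (outside⇒≢ G a V₁∪x z-out) z∉V₁))

        x-joins-V₂ : (∀ w → ¬ (nbr G x w ∧ V₁ w) ≡ true) →
                     ∀ y z → V₁ y ≡ true → Outside G a V₁ z ≡ true → adj G y z ≡ false
        x-joins-V₂ no-nbr-in-V₁ y z y∈V₁ z-out with z ≟ x
        ... | no z≢x = no-edge-G y∈V₁ (outside⇒V G a V₁ z-out) z≢x (outside⇒≢ G a V₁ z-out) (outside⇒∉ G a V₁ z-out)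
        ... | yes refl with adj G y x in yx
        ...   | false = refl
        ...   | true  = contradiction (∧-intro (nbr-sym G-simple (nbr-intro G Vx yx (V-elim⇒≢ G (inside-V y∈V₁)))) y∈V₁)
                                      (no-nbr-in-V₁ y)

      -- x goes to the side of V₁ if it has a neighbour in V₁, and to the other side otherwise
      lift-separation : V G a ≡ true → ∃ (λ y → V₁ y ≡ true) → ∃ (λ z → Outside (elim G x) a V₁ z ≡ true) →
                        IsSeparationClique G (singleton a)
      lift-separation Va (y₀ , y₀∈V₁) (z₀ , z₀-out) with any? (λ w → (nbr G x w ∧ V₁ w) ≟ᵇ true)
      ... | yes (w , xw∧w∈V₁) =
        separation V₁∪x Va inside∪x (y₀ , subst (λ b → (b ∨ (y₀ == x)) ≡ true) (sym y₀∈V₁) refl) (z₀ , z₀-out′)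
                   (x-joins-V₁ (∧-elimˡ (nbr G x w) xw∧w∈V₁) (∧-elimʳ (nbr G x w) xw∧w∈V₁))
        where
        inside∪x : ∀ y → V₁∪x y ≡ true → (V G y ∧ not (singleton a y)) ≡ true
        inside∪x y y∈ with ∨-elim (V₁ y) y∈
        ... | inj₁ y∈V₁ = inside-G y y∈V₁
        ... | inj₂ y=x rewrite ==⇒≡ y=x = inside-intro G a Vx x≢a
        z₀-out′ : Outside G a V₁∪x z₀ ≡ true
        z₀-out′ = outside-intro G a V₁∪x (V-elim⇒V G Vz₀) (outside⇒≢ (elim G x) a V₁ z₀-out)
                    (subst₂ (λ b c → (b ∨ c) ≡ false) (sym (outside⇒∉ (elim G x) a V₁ z₀-out)) (sym (≢⇒==false (V-elim⇒≢ G Vz₀))) refl)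
          where Vz₀ = outside⇒V (elim G x) a V₁ z₀-out
      ... | no no-nbr-in-V₁ =
        separation V₁ Va inside-G (y₀ , y₀∈V₁)
                   (z₀ , outside-intro G a V₁ (V-elim⇒V G (outside⇒V (elim G x) a V₁ z₀-out))
                                       (outside⇒≢ (elim G x) a V₁ z₀-out) (outside⇒∉ (elim G x) a V₁ z₀-out))
                   (x-joins-V₂ (λ w xw∧w∈V₁ → no-nbr-in-V₁ (w , xw∧w∈V₁)))

    separation-elim : ∀ {x a} → x ≢ a → V G x ≡ true →
                      IsSeparationClique (elim G x) (singleton a) → IsSeparationClique G (singleton a)
    separation-elim {x} {a} x≢a Vx (a-in-V , _ , V₁ , inside , y₀∈V₁ , z₀-out , no-edge) =
      lift-separation x≢a Vx V₁ inside no-edge (V-elim⇒V G (a-in-V a (==-refl a))) y₀∈V₁ z₀-out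

-- Eliminating two non-adjacent vertices

module _ {N : ℕ} where

  module _ {G : Graph N} (G-simple : IsSimpleGraph G) {x a : Fin N} (x≢a : x ≢ a) (a≁x : adj G a x ≡ false) where

    nbr-elim-nonadj : ∀ {c} → nbr (elim G a) x c ≡ true → nbr G x c ≡ true × c ≢ a
    nbr-elim-nonadj {c} xc with nbr-elim⁻ G {a} {x} {c} xc
    ... | inj₁ xc×c≢a = xc×c≢a
    ... | inj₂ (ax , _) = contradiction (trans (sym (nbr⇒adj G ax)) a≁x) true≢false

    fillPair-elim-nonadj : ∀ {c d} → fillPair (elim G a) x c d ≡ true → fillPair G x c d ≡ true
    fillPair-elim-nonadj {c} {d} h with fillPair-elim (elim G a) h
    ... | xc′ , xd′ , ¬cd′ , c≢d with nbr-elim-nonadj xc′ | nbr-elim-nonadj xd′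
    ...   | xc , c≢a | xd , d≢a = fillPair-intro G xc xd ¬cd c≢d
      where
      ¬cd : adj G c d ≡ false
      ¬cd = ¬-not λ cd → true≢false
        (trans (sym (elim-keeps-adj G {a} cd (V-elim-intro G (nbr⇒V G xc) c≢a) (V-elim-intro G (nbr⇒V G xd) d≢a))) ¬cd′)

    elim-comm : V G x ≡ true → V G a ≡ true → elim (elim G x) a ≈ᴳ elim (elim G a) x
    elim-comm Vx Va = record { V-eq = λ y → ⇔ᵇ-elim (V-shape (V G y) (y == x) (y == a)) ; adj-eq = adj-eq′ }
      where
      open IsSimpleGraph G-simple renaming (sym to adj-sym)
      V-shape : ∀ Vy yx ya → ((Vy ∧ not yx) ∧ not ya ⇔ᵇ (Vy ∧ not ya) ∧ not yx) ≡ true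
      V-shape = all-true-sound 3 _ refl
      shape : ∀ A Vc Vd ca da cx dx cd axc axd aac aad →
        let Vcx = Vc ∧ not cx ; Vdx = Vd ∧ not dx ; Vca = Vc ∧ not ca ; Vda = Vd ∧ not da
            Gx = A ∧ Vcx ∧ Vdx ∨ (Vc ∧ axc ∧ not cx) ∧ (Vd ∧ axd ∧ not dx) ∧ not cd
            Ga = A ∧ Vca ∧ Vda ∨ (Vc ∧ aac ∧ not ca) ∧ (Vd ∧ aad ∧ not da) ∧ not cd in
        (A ⇒ᵇ Vc) ⇒ᵇ (A ⇒ᵇ Vd) ⇒ᵇ (aac ⇒ᵇ Vc) ⇒ᵇ (aad ⇒ᵇ Vd) ⇒ᵇ (axc ⇒ᵇ Vc) ⇒ᵇ (axd ⇒ᵇ Vd) ⇒ᵇ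
        (ca ⇒ᵇ not aac) ⇒ᵇ (da ⇒ᵇ not aad) ⇒ᵇ (cx ⇒ᵇ not axc) ⇒ᵇ (dx ⇒ᵇ not axd) ⇒ᵇ
        (ca ⇒ᵇ not axc) ⇒ᵇ (da ⇒ᵇ not axd) ⇒ᵇ (cx ⇒ᵇ not aac) ⇒ᵇ (dx ⇒ᵇ not aad) ⇒ᵇ
        (Gx ∧ (Vcx ∧ not ca) ∧ (Vdx ∧ not da) ∨ (Vcx ∧ (aac ∧ true ∧ Vcx ∨ false) ∧ not ca) ∧ (Vdx ∧ (aad ∧ true ∧ Vdx ∨ false) ∧ not da) ∧ not cd
         ⇔ᵇ Ga ∧ (Vca ∧ not cx) ∧ (Vda ∧ not dx) ∨ (Vca ∧ (axc ∧ true ∧ Vca ∨ false) ∧ not cx) ∧ (Vda ∧ (axd ∧ true ∧ Vda ∨ false) ∧ not dx) ∧ not cd)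
        ≡ true
      shape = all-true-sound 12 _ refl
      x≁a : adj G x a ≡ false
      x≁a = trans (adj-sym x a) a≁x
      adj-eq′ : ∀ c d → adj (elim (elim G x) a) c d ≡ adj (elim (elim G a) x) c d
      adj-eq′ c d rewrite Vx | Va | a≁x | x≁a | ≢⇒==false x≢a | ≢⇒==false (x≢a ∘′ sym)
                        | ==-sym x c | ==-sym x d | ==-sym a c | ==-sym a d =
        ⇔ᵇ-elim (shape (adj G c d) (V G c) (V G d) (c == a) (d == a) (c == x) (d == x) (c == d) (adj G x c) (adj G x d) (adj G a c) (adj G a d)
          ∵ adj⇒ᵇV G-simple c d ∵ adj⇒ᵇVʳ G-simple c d ∵ adj⇒ᵇVʳ G-simple a c ∵ adj⇒ᵇVʳ G-simple a d
          ∵ adj⇒ᵇVʳ G-simple x c ∵ adj⇒ᵇVʳ G-simple x d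
          ∵ ==⇒ᵇ¬adj G-simple c a a (irrefl a) ∵ ==⇒ᵇ¬adj G-simple d a a (irrefl a)
          ∵ ==⇒ᵇ¬adj G-simple c x x (irrefl x) ∵ ==⇒ᵇ¬adj G-simple d x x (irrefl x)
          ∵ ==⇒ᵇ¬adj G-simple c a x x≁a ∵ ==⇒ᵇ¬adj G-simple d a x x≁a
          ∵ ==⇒ᵇ¬adj G-simple c x a a≁x ∵ ==⇒ᵇ¬adj G-simple d x a a≁x)

-- A vertex of degree two

record DegreeTwo {N : ℕ} (G : Graph N) (a u v : Fin N) : Set where
  field
    simple      : IsSimpleGraph G
    a∈V         : V G a ≡ true
    u≢v         : u ≢ v
    a~u         : adj G a u ≡ true
    a~v         : adj G a v ≡ true
    only-u-v    : ∀ y → adj G a y ≡ true → y ≡ u ⊎ y ≡ v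
    u≁v         : adj G u v ≡ false
    ¬separating : ¬ IsSeparationClique G (singleton a)

Cheaper : ∀ {N} → Graph N → Fin N → List (Fin N) → Set
Cheaper {N} G a σ = Σ (List (Fin N)) λ ρ → IsOrdering (elim G a) ρ × fillIn₂ (elim G a) ρ + 2 ≤ fillIn₂ G σ

module _ {N : ℕ} {G : Graph N} {a u v : Fin N} (D : DegreeTwo G a u v) where

  open DegreeTwo D

  degreeTwo-swap : DegreeTwo G a v u
  degreeTwo-swap = record
    { simple = simple ; a∈V = a∈V ; u≢v = u≢v ∘′ sym ; a~u = a~v ; a~v = a~u
    ; only-u-v = λ y ay → Data.Sum.swap (only-u-v y ay)
    ; u≁v = trans (IsSimpleGraph.sym simple v u) u≁v ; ¬separating = ¬separating }

  u≢a : u ≢ a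
  u≢a u≡a = adj⇒≢ simple a~u (sym u≡a)

  v≢a : v ≢ a
  v≢a v≡a = adj⇒≢ simple a~v (sym v≡a)

  a-u : nbr G a u ≡ true
  a-u = nbr-intro G (adj⇒Vʳ simple a~u) a~u (u≢a ∘′ sym)

  a-v : nbr G a v ≡ true
  a-v = nbr-intro G (adj⇒Vʳ simple a~v) a~v (v≢a ∘′ sym)

  a≁ : ∀ {x} → x ≢ u → x ≢ v → adj G a x ≡ false
  a≁ {x} x≢u x≢v = ¬-not λ ax → [ x≢u , x≢v ]′ (only-u-v x ax)

  deficiency₂-a : deficiency₂ G a ≡ 2
  deficiency₂-a = ≤-antisym at-most-two at-least-two
    where
    entry≤ : ∀ c d → 𝟙 (fillPair G a c d) ≤ 𝟙 ((c == u) ∧ (d == v)) + 𝟙 ((c == v) ∧ (d == u))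
    entry≤ c d with fillPair G a c d in e
    ... | false = z≤n
    ... | true with fillPair-elim G e
    ...   | ac , ad , _ , c≢d with only-u-v c (nbr⇒adj G ac) | only-u-v d (nbr⇒adj G ad)
    ...     | inj₁ refl | inj₁ refl = contradiction refl c≢d
    ...     | inj₂ refl | inj₂ refl = contradiction refl c≢d
    ...     | inj₁ refl | inj₂ refl rewrite ==-refl u | ==-refl v = s≤s z≤n
    ...     | inj₂ refl | inj₁ refl rewrite ==-refl u | ==-refl v = m≤n+m 1 _
    at-most-two : deficiency₂ G a ≤ 2
    at-most-two = ≤-trans (∑²-mono-≤ {N} entry≤)
      (≤-reflexive (trans (∑²-distrib-+ (λ c d → 𝟙 ((c == u) ∧ (d == v))) _) (cong₂ _+_ (∑²-𝟙-point u v) (∑²-𝟙-point v u))))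
    at-least-two : 2 ≤ deficiency₂ G a
    at-least-two with ∑²-≥-pair (λ c d → 𝟙 (fillPair G a c d)) {u} {v} v u u≢v
    ... | pair≤ rewrite fillPair-intro G a-u a-v u≁v u≢v
                      | fillPair-intro G a-v a-u (trans (IsSimpleGraph.sym simple v u) u≁v) (u≢v ∘′ sym) = pair≤

  degree-a≤2 : degree G a ≤ 2
  degree-a≤2 = ≤-trans (∑-mono-≤ {N} entry≤)
    (≤-reflexive (trans (∑-distrib-+ (λ d → 𝟙 (d == u)) _) (cong₂ _+_ (∑-𝟙-== u) (∑-𝟙-== v))))
    where
    entry≤ : ∀ d → 𝟙 (nbr G a d) ≤ 𝟙 (d == u) + 𝟙 (d == v)
    entry≤ d with nbr G a d in ad
    ... | false = z≤n
    ... | true with only-u-v d (nbr⇒adj G ad)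
    ...   | inj₁ refl rewrite ==-refl u = s≤s z≤n
    ...   | inj₂ refl rewrite ==-refl v = m≤n+m 1 _

  degree-u≥2 : 2 ≤ degree G u
  degree-u≥2 with ¬separation⇒nbr simple ¬separating a~u a~v u≢v
  ... | w , u-w , w≢a with ∑-≥-pair (λ d → 𝟙 (nbr G u d)) {a} {w} (w≢a ∘′ sym)
  ...   | pair≤ rewrite nbr-sym simple a-u | u-w = pair≤

  private
    a≢u : a ≢ u
    a≢u = u≢a ∘′ sym

    π : Fin N → Fin N
    π = swap a u

  open Relabel π (swap-involutive a≢u)

  V-elim-swap : ∀ y → V (elim G u) (π y) ≡ V (elim G a) y
  V-elim-swap y with y == a in y=a
  ... | true rewrite ==⇒≡ y=a | ==-refl u = trans (∧-zeroʳ (V G u)) (sym (∧-zeroʳ (V G a)))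
  ... | false with y == u in y=u
  ...   | true rewrite ==⇒≡ y=u | ≢⇒==false a≢u | a∈V | adj⇒Vʳ simple a~u = refl
  ...   | false rewrite y=u = refl

  kept-image : ∀ {p q} → adj G p q ≡ true → p ≢ a → q ≢ a → adj (elim G u) (π p) (π q) ≡ true
  kept-image {p} {q} pq p≢a q≢a with p ≟ u | q ≟ u
  ... | yes refl | yes refl = contradiction refl (adj⇒≢ simple pq)
  ... | yes refl | no q≢u rewrite ≢⇒==false u≢a | ≢⇒==false q≢a =
    elim-fills G {u} (nbr-sym simple a-u) (nbr-intro G (adj⇒Vʳ simple pq) pq (q≢u ∘′ sym)) (q≢a ∘′ sym)
  ... | no p≢u | yes refl rewrite ≢⇒==false u≢a | ≢⇒==false p≢a =
    elim-fills G {u} (nbr-sym simple (nbr-intro G (adj⇒Vʳ simple pq) pq p≢u)) (nbr-sym simple a-u) p≢a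
  ... | no p≢u | no q≢u rewrite ≢⇒==false p≢a | ≢⇒==false q≢a =
    elim-keeps-adj G pq (V-elim-intro G (adj⇒V simple pq) p≢u) (V-elim-intro G (adj⇒Vʳ simple pq) q≢u)

  filled-image : ∀ {p q} → nbr G a p ≡ true → nbr G a q ≡ true → p ≢ q → adj (elim G u) (π p) (π q) ≡ true
  filled-image {p} {q} ap aq p≢q with only-u-v p (nbr⇒adj G ap) | only-u-v q (nbr⇒adj G aq)
  ... | inj₁ refl | inj₁ refl = contradiction refl p≢q
  ... | inj₂ refl | inj₂ refl = contradiction refl p≢q
  ... | inj₁ refl | inj₂ refl rewrite swap-u a≢u | swap-other a≢u v≢a (u≢v ∘′ sym) =
    elim-keeps-adj G a~v (V-elim-intro G a∈V a≢u) (V-elim-intro G (adj⇒Vʳ simple a~v) (u≢v ∘′ sym))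
  ... | inj₂ refl | inj₁ refl rewrite swap-u a≢u | swap-other a≢u v≢a (u≢v ∘′ sym) =
    elim-keeps-adj G (trans (IsSimpleGraph.sym simple v a) a~v) (V-elim-intro G (adj⇒Vʳ simple a~v) (u≢v ∘′ sym)) (V-elim-intro G a∈V a≢u)

  edge-image : ∀ {p q} → adj (elim G a) p q ≡ true → adj (elim G u) (π p) (π q) ≡ true
  edge-image {p} {q} h with ∨-elim (adj G p q ∧ V (elim G a) p ∧ V (elim G a) q) h
  ... | inj₁ kept = kept-image (∧-elimˡ (adj G p q) kept)
                               (V-elim⇒≢ G (∧-elimˡ (V (elim G a) p) (∧-elimʳ (adj G p q) kept)))
                               (V-elim⇒≢ G (∧-elimʳ (V (elim G a) p) (∧-elimʳ (adj G p q) kept)))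
  ... | inj₂ filled = filled-image (∧-elimˡ (nbr G a p) filled) (∧-elimˡ (nbr G a q) (∧-elimʳ (nbr G a p) filled))
                                   (==false⇒≢ (not-elim (∧-elimʳ (nbr G a q) (∧-elimʳ (nbr G a p) filled))))

  relabel-elim-a⊆elim-u : relabel (elim G a) ⊆ᴳ elim G u
  relabel-elim-a⊆elim-u = record
    { V-eq = λ y → trans (sym (V-elim-swap (π y))) (cong (V (elim G u)) (swap-involutive a≢u y))
    ; adj⊆ = λ {c} {d} h → subst₂ (λ p q → adj (elim G u) p q ≡ true) (swap-involutive a≢u c) (swap-involutive a≢u d) (edge-image h) }

  first-u : ∀ {σ} → IsOrdering (elim G u) σ → Cheaper G a (u ∷ σ)
  first-u {σ} σ-ord =
    map π σ ,
    isOrdering-cong {G = relabel (elim G u)} {H = elim G a} V-elim-swap (isOrdering-relabel {G = elim G u} σ-ord) ,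
    cheaper
    where
    open +-*-Solver
    Gₐ = elim G a
    Gᵤ = elim G u
    F = fillIn₂ (relabel Gₐ) σ
    F≡ : fillIn₂ Gₐ (map π σ) ≡ F
    F≡ = trans (fillIn₂-cong (≈ᴳ-sym (relabel-involutive Gₐ)) (map π σ)) (fillIn₂-relabel σ (relabel Gₐ))
    mono : edges₂ Gₐ + F ≤ edges₂ Gᵤ + fillIn₂ Gᵤ σ
    mono = ≤-trans (≤-reflexive (cong (_+ F) (sym (edges₂-relabel Gₐ))))
                   (edges₂+fillIn₂-mono (relabel-isSimple (elim-isSimple simple a)) (elim-isSimple simple u) relabel-elim-a⊆elim-u σ)
    E = edges₂ G
    Dᵤ = deficiency₂ G u
    eliminate-a : E + 2 ≡ edges₂ Gₐ + 2 * degree G a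
    eliminate-a = trans (cong (E +_) (sym deficiency₂-a)) (edges₂-elim simple a)
    -- edges₂ Gₐ ≥ E - 2 since deg a ≤ 2, and edges₂ Gᵤ ≤ E + Dᵤ - 4 since deg u ≥ 2
    cheaper : fillIn₂ Gₐ (map π σ) + 2 ≤ Dᵤ + fillIn₂ Gᵤ σ
    cheaper rewrite F≡ = +-cancelˡ-≤ (E + 2) (F + 2) (Dᵤ + fillIn₂ Gᵤ σ) (begin
      (E + 2) + (F + 2)                                   ≡⟨ cong (_+ (F + 2)) eliminate-a ⟩
      (edges₂ Gₐ + 2 * degree G a) + (F + 2)              ≤⟨ +-monoˡ-≤ (F + 2) (+-monoʳ-≤ (edges₂ Gₐ) (*-monoʳ-≤ 2 degree-a≤2)) ⟩
      (edges₂ Gₐ + 4) + (F + 2)                           ≡⟨ solve 2 (λ e f → (e :+ con 4) :+ (f :+ con 2) := (e :+ f) :+ con 6) refl (edges₂ Gₐ) F ⟩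
      (edges₂ Gₐ + F) + 6                                 ≤⟨ +-mono-≤ mono (+-monoˡ-≤ 2 (*-monoʳ-≤ 2 degree-u≥2)) ⟩
      (edges₂ Gᵤ + fillIn₂ Gᵤ σ) + (2 * degree G u + 2)   ≡⟨ solve 3 (λ e f d → (e :+ f) :+ (d :+ con 2) := (e :+ d) :+ (f :+ con 2)) refl (edges₂ Gᵤ) _ _ ⟩
      (edges₂ Gᵤ + 2 * degree G u) + (fillIn₂ Gᵤ σ + 2)   ≡⟨ cong (_+ (fillIn₂ Gᵤ σ + 2)) (edges₂-elim simple u) ⟨
      (E + Dᵤ) + (fillIn₂ Gᵤ σ + 2)                       ≡⟨ solve 3 (λ e d f → (e :+ d) :+ (f :+ con 2) := (e :+ con 2) :+ (d :+ f)) refl E Dᵤ _ ⟩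
      (E + 2) + (Dᵤ + fillIn₂ Gᵤ σ)                       ∎)
      where open Data.Nat.Properties.≤-Reasoning

  first-a : ∀ {σ} → IsOrdering G (a ∷ σ) → Cheaper G a (a ∷ σ)
  first-a {σ} σ-ord = σ , isOrdering-tail {G = G} σ-ord , ≤-reflexive (trans (+-comm _ 2) (cong (_+ fillIn₂ (elim G a) σ) (sym deficiency₂-a)))

  module _ {x : Fin N} {σ : List (Fin N)} (σ-ord : IsOrdering G (x ∷ σ)) (x≢a : x ≢ a) (x≢u : x ≢ u) (x≢v : x ≢ v) where

    private
      a≁x : adj G a x ≡ false
      a≁x = a≁ x≢u x≢v

      Vx : V G x ≡ true
      Vx = isOrdering-head {G = G} σ-ord

      tail-ord : IsOrdering (elim G x) σ
      tail-ord = isOrdering-tail {G = G} σ-ord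

      elim-comm-a : elim (elim G x) a ≈ᴳ elim (elim G a) x
      elim-comm-a = elim-comm simple x≢a a≁x Vx a∈V

    first-common-nbr : (nbr G x u ∧ nbr G x v) ≡ true → Cheaper G a (x ∷ σ)
    first-common-nbr common =
      x ∷ without a σ ,
      isOrdering-∷ {G = elim G a} (V-elim-intro G Vx x≢a)
        (isOrdering-cong {G = delete (elim G x) a} {H = elim (elim G a) x} (λ y → sym (V-eq Gₐₓ≈ y)) (isOrdering-without {G = elim G x} a tail-ord)) ,
      ≤-trans (≤-reflexive (xy∙z≈xz∙y (deficiency₂ (elim G a) x) _ 2)) (+-mono-≤ deficiency-drop fill-bound)
      where
      x-u = ∧-elimˡ (nbr G x u) common
      x-v = ∧-elimʳ (nbr G x u) common
      a-simplicial : IsSimplicial (elim G x) a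
      a-simplicial c d ac ad c≢d with nbr-elim⁻ G {x} {a} {c} ac | nbr-elim⁻ G {x} {a} {d} ad
      ... | inj₂ (xa , _) | _ = contradiction (trans (sym (nbr⇒adj G (nbr-sym simple xa))) a≁x) true≢false
      ... | _ | inj₂ (xa , _) = contradiction (trans (sym (nbr⇒adj G (nbr-sym simple xa))) a≁x) true≢false
      ... | inj₁ (ac′ , _) | inj₁ (ad′ , _) with only-u-v c (nbr⇒adj G ac′) | only-u-v d (nbr⇒adj G ad′)
      ...   | inj₁ refl | inj₁ refl = contradiction refl c≢d
      ...   | inj₂ refl | inj₂ refl = contradiction refl c≢d
      ...   | inj₁ refl | inj₂ refl = elim-fills G x-u x-v u≢v
      ...   | inj₂ refl | inj₁ refl = elim-fills G x-v x-u (u≢v ∘′ sym)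
      Gₐₓ≈ : elim (elim G a) x ≈ᴳ delete (elim G x) a
      Gₐₓ≈ = ≈ᴳ-trans (≈ᴳ-sym elim-comm-a) (elim≈delete (elim-isSimple simple x) a-simplicial)
      fill-bound : fillIn₂ (elim (elim G a) x) (without a σ) ≤ fillIn₂ (elim G x) σ
      fill-bound = ≤-trans (≤-reflexive (fillIn₂-cong Gₐₓ≈ (without a σ)))
                           (fillIn₂-delete-simplicial σ (elim-isSimple simple x) a-simplicial)
      -- uv is a fill pair of x in G but an edge of G_a
      deficiency-drop : deficiency₂ (elim G a) x + 2 ≤ deficiency₂ G x
      deficiency-drop = ∑²-𝟙-gap (fillPair (elim G a) x) (fillPair G x) (fillPair-elim-nonadj simple x≢a a≁x) u≢v
        (filled-pair (elim-fills G a-u a-v u≢v)) (fillPair-intro G x-u x-v u≁v u≢v)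
        (filled-pair (elim-fills G a-v a-u (u≢v ∘′ sym))) (fillPair-intro G x-v x-u (trans (IsSimpleGraph.sym simple v u) u≁v) (u≢v ∘′ sym))
        where
        filled-pair : ∀ {c d} → adj (elim G a) c d ≡ true → fillPair (elim G a) x c d ≡ false
        filled-pair cd = ¬-not λ h → true≢false (trans (sym cd) (proj₁ (proj₂ (proj₂ (fillPair-elim (elim G a) h)))))

    degreeTwo-elim : (nbr G x u ∧ nbr G x v) ≡ false → DegreeTwo (elim G x) a u v
    degreeTwo-elim ¬common = record
      { simple = elim-isSimple simple x
      ; a∈V = V-elim-intro G a∈V (x≢a ∘′ sym)
      ; u≢v = u≢v
      ; a~u = elim-keeps-adj G a~u (V-elim-intro G a∈V (x≢a ∘′ sym)) (V-elim-intro G (adj⇒Vʳ simple a~u) (x≢u ∘′ sym))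
      ; a~v = elim-keeps-adj G a~v (V-elim-intro G a∈V (x≢a ∘′ sym)) (V-elim-intro G (adj⇒Vʳ simple a~v) (x≢v ∘′ sym))
      ; only-u-v = only-u-v′
      ; u≁v = u≁v′
      ; ¬separating = λ sep → ¬separating (separation-elim simple x≢a Vx sep)
      }
      where
      only-u-v′ : ∀ y → adj (elim G x) a y ≡ true → y ≡ u ⊎ y ≡ v
      only-u-v′ y h with ∨-elim (adj G a y ∧ V (elim G x) a ∧ V (elim G x) y) h
      ... | inj₁ kept   = only-u-v y (∧-elimˡ (adj G a y) kept)
      ... | inj₂ filled = contradiction (trans (sym (nbr⇒adj G (nbr-sym simple (∧-elimˡ (nbr G x a) filled)))) a≁x) true≢false
      u≁v′ : adj (elim G x) u v ≡ false
      u≁v′ rewrite u≁v | sym (∧-assoc (nbr G x u) (nbr G x v) (not (u == v))) | ¬common = refl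

    first-other : (nbr G x u ∧ nbr G x v) ≡ false →
                  (∀ {H} → DegreeTwo H a u v → IsOrdering H σ → Cheaper H a σ) → Cheaper G a (x ∷ σ)
    first-other ¬common exchange-σ with exchange-σ (degreeTwo-elim ¬common) tail-ord
    ... | ρ , ρ-ord , cheaper =
      x ∷ ρ ,
      isOrdering-∷ {G = elim G a} (V-elim-intro G Vx x≢a) (isOrdering-cong {G = elim (elim G x) a} {H = elim (elim G a) x} (V-eq elim-comm-a) ρ-ord) ,
      ≤-trans (≤-reflexive (+-assoc (deficiency₂ (elim G a) x) _ 2))
              (+-mono-≤ (∑²-mono-≤ {N} (λ c d → 𝟙-mono (fillPair-elim-nonadj simple x≢a a≁x)))
                        (≤-trans (≤-reflexive (cong (_+ 2) (fillIn₂-cong (≈ᴳ-sym elim-comm-a) ρ))) cheaper))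

exchange : ∀ {N} σ {G : Graph N} {a u v} → DegreeTwo G a u v → IsOrdering G σ → Cheaper G a σ
exchange []      D (_ , mem) with () ← Equivalence.from (mem _) (DegreeTwo.a∈V D)
exchange (x ∷ σ) {G} {a} {u} {v} D σ-ord with x ≟ a
... | yes refl = first-a D σ-ord
... | no x≢a with x ≟ u
...   | yes refl = first-u D (isOrdering-tail {G = G} σ-ord)
...   | no x≢u with x ≟ v
...     | yes refl = first-u (degreeTwo-swap D) (isOrdering-tail {G = G} σ-ord)
...     | no x≢v with nbr G x u ∧ nbr G x v in common
...       | true  = first-common-nbr D σ-ord x≢a x≢u x≢v common
...       | false = first-other D σ-ord x≢a x≢u x≢v common (exchange σ)

lemma7 : (N : ℕ) (G : Graph N) → IsSimpleGraph G →
    (a u v : Fin N) → V G a ≡ true →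
    u ≢ v → adj G a u ≡ true → adj G a v ≡ true →
    (∀ y → adj G a y ≡ true → (y ≡ u) ⊎ (y ≡ v)) →
    adj G u v ≡ false →
    ¬ IsSeparationClique G (singleton a) →
    (τ : List (Fin N)) → IsMinFillOrdering (elim G a) τ →
    IsMinFillOrdering G (a ∷ τ)
lemma7 N G G-simple a u v a∈V u≢v a~u a~v only-u-v u≁v ¬separating τ (τ-ord , τ-min) =
  isOrdering-∷ {G = G} a∈V τ-ord , optimal
  where
  D : DegreeTwo G a u v
  D = record { simple = G-simple ; a∈V = a∈V ; u≢v = u≢v ; a~u = a~u ; a~v = a~v
             ; only-u-v = only-u-v ; u≁v = u≁v ; ¬separating = ¬separating }
  optimal : ∀ σ → IsOrdering G σ → fillIn G (a ∷ τ) ≤ fillIn G σ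
  optimal σ σ-ord with exchange σ D σ-ord
  ... | ρ , ρ-ord , cheaper = *-cancelˡ-≤ 2 (begin
    2 * fillIn G (a ∷ τ)                     ≡⟨ fillIn₂≡ G-simple (a ∷ τ) ⟨
    deficiency₂ G a + fillIn₂ (elim G a) τ   ≡⟨ cong₂ _+_ (deficiency₂-a D) (fillIn₂≡ Gₐ-simple τ) ⟩
    2 + 2 * fillIn (elim G a) τ              ≤⟨ +-monoʳ-≤ 2 (*-monoʳ-≤ 2 (τ-min ρ ρ-ord)) ⟩
    2 + 2 * fillIn (elim G a) ρ              ≡⟨ trans (+-comm _ 2) (cong (2 +_) (fillIn₂≡ Gₐ-simple ρ)) ⟨
    fillIn₂ (elim G a) ρ + 2                 ≤⟨ cheaper ⟩
    fillIn₂ G σ                              ≡⟨ fillIn₂≡ G-simple σ ⟩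
    2 * fillIn G σ                           ∎)
    where
    open Data.Nat.Properties.≤-Reasoning
    Gₐ-simple = elim-isSimple G-simple a
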